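{- Let $h\ge1$ and $k\ge0$ be integers with $h+k\ge2$, and let $a$ be a leaf-edge of $G_{h,k}$. For every nonnegative even integer $t$, $$\mathrm{vol}^{\mathrm{ev}}_a(t\mathcal{P}_{G_{h,k}})-\mathrm{vol}^{\mathrm{od}}_a(t\mathcal{P}_{G_{h,k}})=\begin{cases}(\frac t2+1)^k & \text{if } t\equiv0\pmod4\text{ or } h=1,\\ 0 & \text{if } t\equiv2\pmod4\text{ and } h\ge2.\end{cases}$$
   Context: A $\{1,3\}$-graph is a finite graph (loops and parallel edges allowed, a loop contributing $2$ to the degree) in which every node has degree $1$ (leaf) or $3$ (internal node); $E$ is the edge set; a leaf-edge is an edge incident with a leaf. For each internal node $v$ with incident edges $a,b,c$ listed with multiplicity (a loop listed twice), $\mathcal{P}_G\subset\mathbb{R}^E$ is defined by $w_a\le w_b+w_c$, $w_b\le w_a+w_c$, $w_c\le w_a+w_b$, $w_a+w_b+w_c\le1$ for all internal $v$, and $0\le w_e\le\frac12$ if $G$ is a single edge $e$. A caterpillar is a tree whose removal of all leaves leaves a path (the central path) or the empty graph; legs are edges off the central path. For $h+k\ge2$, $G_{h,k}$ is obtained from a $\{1,3\}$-tree caterpillar with $h+k$ leaves by attaching a loop at $k$ of its leaves, so that in the order of the legs along the central path the legs with loops are consecutive and those without are consecutive. For $\mathcal{X}\subset\mathbb{R}^E$, $\mathrm{vol}^{\mathrm{ev}}_a(\mathcal{X})$ (resp. $\mathrm{vol}^{\mathrm{od}}_a(\mathcal{X})$) is the number of $w\in\mathcal{X}\cap\mathbb{Z}^E$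 with $w_a$ even (resp. odd). -}

module Defs where

open import Data.Nat as ℕ using (ℕ; zero; suc; _∸_; _⊓_; _≡ᵇ_)
open import Data.Bool using (if_then_else_)
open import Data.Product using (_×_; _,_; proj₁; proj₂; Σ; ∃)
open import Data.Sum using (_⊎_)
open import Data.Fin using (Fin)
open import Data.List using (List; []; _∷_; _++_; map; upTo; length; concatMap; allFin; lookup)
open import Data.List.Membership.Propositional using (_∈_)
open import Data.List.Relation.Unary.Unique.Propositional using (Unique)
open import Data.Vec as Vec using (Vec)
open import Data.Integer as ℤ using (ℤ; +_; _≤_; _+_; _*_)
open import Data.Integer.Divisibility using (_∣_)
open import Function.Bundles using (_⇔_)
open import Relation.Binary.PropositionalEquality using (_≡_)
open import Relation.Nullary using (¬_)

-- Finite graphs (loops and parallel edges allowed) are given by an edge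
-- list: nodes are natural-number labels, edge number i (i : Fin m, m the
-- length of the list) has the two endpoints stored at position i.
-- A loop is an edge (x , x).

Graph : Set
Graph = List (ℕ × ℕ)

nE : Graph → ℕ
nE G = length G

edge : (G : Graph) → Fin (nE G) → ℕ × ℕ
edge G i = lookup G i

-- The edges incident with node v, listed with multiplicity
-- (a loop at v is listed twice).
incident : (G : Graph) → ℕ → List (Fin (nE G))
incident G v = concatMap inc (allFin (nE G))
  where
  inc : Fin (nE G) → List (Fin (nE G))
  inc i = (if proj₁ (edge G i) ≡ᵇ v then i ∷ [] else [])
       ++ (if proj₂ (edge G i) ≡ᵇ v then i ∷ [] else [])

degree : Graph → ℕ → ℕ
degree G v = length (incident G v)

IsLeafEdge : (G : Graph) → Fin (nE G) → Set
IsLeafEdge G a = degree G (proj₁ (edge G a)) ≡ 1 ⊎ degree G (proj₂ (edge G a)) ≡ 1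

-- P_G is cut out by: for each internal node v with incident edges a,b,c
-- (with multiplicity): w_a ≤ w_b + w_c, w_b ≤ w_a + w_c, w_c ≤ w_a + w_b,
-- w_a + w_b + w_c ≤ 1; and 0 ≤ w_e ≤ 1/2 if G is a single edge e.
-- Dilating by t ≥ 0 multiplies the right-hand sides by t
-- (the single-edge condition becomes 0 ≤ w_e, 2 w_e ≤ t).

Weight : Graph → Set
Weight G = Vec ℤ (nE G)

_at_ : {m : ℕ} → Vec ℤ m → Fin m → ℤ
w at i = Vec.lookup w i

NodeConstraints : (G : Graph) → ℕ → Weight G → Set
NodeConstraints G t w =
  ∀ (v : ℕ) (a b c : Fin (nE G)) → incident G v ≡ a ∷ b ∷ c ∷ [] →
    (w at a ≤ w at b + w at c) × (w at b ≤ w at a + w at c) ×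
    (w at c ≤ w at a + w at b) × (w at a + w at b + w at c ≤ + t)

SingleEdgeConstraints : (G : Graph) → ℕ → Weight G → Set
SingleEdgeConstraints G t w =
  (e : Fin (nE G)) → nE G ≡ 1 → (+ 0 ≤ w at e) × (+ 2 * (w at e) ≤ + t)

InDilate : (G : Graph) → ℕ → Weight G → Set
InDilate G t w = NodeConstraints G t w × SingleEdgeConstraints G t w

HasCard : {A : Set} → (A → Set) → ℕ → Set
HasCard {A} P n = Σ (List A) λ L → Unique L × (∀ x → (x ∈ L) ⇔ P x) × length L ≡ n

Even Odd : ℤ → Set
Even x = + 2 ∣ x
Odd x = ¬ (+ 2 ∣ x)

VolEv : (G : Graph) → Fin (nE G) → ℕ → ℕ → Set
VolEv G a t n = HasCard (λ (w : Weight G) → InDilate G t w × Even (w at a)) n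

VolOd : (G : Graph) → Fin (nE G) → ℕ → ℕ → Set
VolOd G a t n = HasCard (λ (w : Weight G) → InDilate G t w × Odd (w at a)) n

-- Caterpillar {1,3}-tree with n leaves: leaves 0,…,n-1 (leg i ends at
-- leaf i), central path nodes n+0,…,n+(n-3).  For n ≥ 3, leg i attaches to path node n + min(i-1, n-3), so
-- the legs in the order 0,…,n-1 are in the order along the central path.

caterpillar : ℕ → Graph
caterpillar (suc (suc zero)) = (0 , 1) ∷ []
caterpillar n =
  map (λ i → (i , n ℕ.+ ((i ∸ 1) ⊓ (n ∸ 3)))) (upTo n)
  ++ map (λ j → (n ℕ.+ j , n ℕ.+ suc j)) (upTo (n ∸ 3))

-- legs 0..h-1 have no loop, legs h..h+k-1 get a loop at their leaf
Ghk : ℕ → ℕ → Graph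
Ghk h k = caterpillar (h ℕ.+ k) ++ map (λ i → (h ℕ.+ i , h ℕ.+ i)) (upTo k)

-- Write t = 2H. The node inequalities force every coordinate of a lattice point of tP_G into
-- [0, H], and vol^ev − vol^od is the signed count ∑_w (−1)^{w_a}. The key fact is that for
-- x, y ≤ H the z completing an admissible triple (x, y, z) form an interval [|x − y|, |x − y| + 2c],
-- so ∑_z (−1)^z [x, y, z admissible] = (−1)^x (−1)^y. Summing out the central path of the
-- caterpillar node by node, starting from the leg a, the sign is passed along the path and the
-- signed count factorises as ∏ over the other legs of ∑_z (−1)^z ω(z), where ω = 1 on a leg
-- without a loop and ω(z) = #{y : (z, y, y) admissible} on a leg with a loop. The first kind of
-- factor is [H even], the second is always H + 1, which gives [H even]^{h−1} (H + 1)^k.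

module Submission where

open import Defs
open import Data.Nat as ℕ using (ℕ; zero; suc; z≤n; s≤s; _≡ᵇ_; _≤ᵇ_; _∸_; _⊓_; _/_; _%_; _^_) renaming (_+_ to _+ℕ_; _*_ to _*ℕ_; _<_ to _<ℕ_; _≤_ to _≤ℕ_)
import Data.Nat.Properties as ℕP
import Data.Nat.DivMod as DM
open import Data.Nat.Divisibility as ND using (divides) renaming (_∣_ to _∣ℕ_)
open import Data.Integer as ℤ using (ℤ; +_; -[1+_]; -_; _+_; _*_; _-_; 0ℤ; 1ℤ; +≤+) renaming (_≤_ to _≤ℤ_)
import Data.Integer.Properties as ℤP
import Data.Integer.Tactic.RingSolver as ZS
import Data.Nat.Tactic.RingSolver as NS
open import Algebra.Properties.CommutativeSemigroup ℤP.+-commutativeSemigroup using (interchange)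
open import Data.Bool using (Bool; true; false; _∧_; T; not; if_then_else_)
import Data.Bool.Properties as BP
open import Data.Unit using (tt)
open import Data.Empty using (⊥; ⊥-elim)
open import Data.Product using (_×_; _,_; proj₁; proj₂; ∃; Σ; Σ-syntax)
open import Data.Sum using (_⊎_; inj₁; inj₂; [_,_]′)
open import Data.Fin using (Fin; zero; suc; toℕ)
import Data.Fin.Properties as FinP
open import Data.Vec as Vec using (Vec; []; _∷_)
import Data.Vec.Properties as VecP
open import Data.Vec.Relation.Unary.All using (All; []; _∷_)
open import Data.List as List using (List; []; _∷_; _++_; map; length; concatMap; concat; tabulate; allFin; applyUpTo; upTo; filter; cartesianProductWith)
import Data.List.Properties as LP
import Data.List.Relation.Unary.All as LA
import Data.List.Relation.Unary.Any as Any
open import Data.List.Relation.Unary.AllPairs using ([]; _∷_)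
open import Data.List.Membership.Propositional using (_∈_)
open import Data.List.Membership.Propositional.Properties using (∈-map⁺; ∈-map⁻; ∈-filter⁺; ∈-filter⁻; ∈-cartesianProductWith⁺; ∈-cartesianProductWith⁻; ∈-upTo⁺; ∈-upTo⁻; ∈-++⁺ˡ; ∈-++⁺ʳ)
open import Data.List.Relation.Unary.Unique.Propositional using (Unique)
open import Data.List.Relation.Unary.Unique.Propositional.Properties using (map⁺; filter⁺; cartesianProductWith⁺; upTo⁺)
open import Function.Bundles using (_⇔_; mk⇔; Equivalence)
open import Relation.Binary.PropositionalEquality
open import Relation.Nullary using (¬_; Dec)
open import Relation.Nullary.Decidable using (T?; ⌊_⌋; _×-dec_; toWitness; fromWitness)

-- Finite sums and products

∑ : ℕ → (ℕ → ℤ) → ℤ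
∑ zero f = 0ℤ
∑ (suc n) f = f 0 + ∑ n (λ i → f (suc i))

∏ : ℕ → (ℕ → ℤ) → ℤ
∏ zero f = 1ℤ
∏ (suc n) f = f 0 * ∏ n (λ i → f (suc i))

∑-cong : ∀ n {f g : ℕ → ℤ} → (∀ i → i <ℕ n → f i ≡ g i) → ∑ n f ≡ ∑ n g
∑-cong zero h = refl
∑-cong (suc n) h = cong₂ _+_ (h 0 (s≤s z≤n)) (∑-cong n (λ i i<n → h (suc i) (s≤s i<n)))

∏-cong : ∀ n {f g : ℕ → ℤ} → (∀ i → i <ℕ n → f i ≡ g i) → ∏ n f ≡ ∏ n g
∏-cong zero h = refl
∏-cong (suc n) h = cong₂ _*_ (h 0 (s≤s z≤n)) (∏-cong n (λ i i<n → h (suc i) (s≤s i<n)))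

∑-distrib-+ : ∀ n (f g : ℕ → ℤ) → ∑ n (λ i → f i + g i) ≡ ∑ n f + ∑ n g
∑-distrib-+ zero f g = refl
∑-distrib-+ (suc n) f g = trans (cong (_+_ (f 0 + g 0)) (∑-distrib-+ n _ _)) (interchange (f 0) (g 0) _ _)

∑-*ˡ : ∀ n c (f : ℕ → ℤ) → ∑ n (λ i → c * f i) ≡ c * ∑ n f
∑-*ˡ zero c f = sym (ℤP.*-zeroʳ c)
∑-*ˡ (suc n) c f = trans (cong (_+_ (c * f 0)) (∑-*ˡ n c _)) (sym (ℤP.*-distribˡ-+ c (f 0) _))

∑-*ʳ : ∀ n c (f : ℕ → ℤ) → ∑ n (λ i → f i * c) ≡ ∑ n f * c
∑-*ʳ n c f = trans (∑-cong n (λ i _ → ℤP.*-comm (f i) c)) (trans (∑-*ˡ n c f) (ℤP.*-comm c _))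

∑-zero : ∀ n {f : ℕ → ℤ} → (∀ i → i <ℕ n → f i ≡ 0ℤ) → ∑ n f ≡ 0ℤ
∑-zero zero h = refl
∑-zero (suc n) h = trans (cong₂ _+_ (h 0 (s≤s z≤n)) (∑-zero n (λ i i<n → h (suc i) (s≤s i<n)))) (ℤP.+-identityˡ _)

∑-comm : ∀ n m (F : ℕ → ℕ → ℤ) → ∑ n (λ i → ∑ m (λ j → F i j)) ≡ ∑ m (λ j → ∑ n (λ i → F i j))
∑-comm zero m F = sym (∑-zero m (λ _ _ → refl))
∑-comm (suc n) m F = trans (cong (_+_ (∑ m (F 0))) (∑-comm n m (λ i → F (suc i)))) (sym (∑-distrib-+ m (F 0) (λ j → ∑ n (λ i → F (suc i) j))))

∑-split : ∀ a b (f : ℕ → ℤ) → ∑ (a +ℕ b) f ≡ ∑ a f + ∑ b (λ i → f (a +ℕ i))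
∑-split zero b f = sym (ℤP.+-identityˡ _)
∑-split (suc a) b f = trans (cong (_+_ (f 0)) (∑-split a b _)) (sym (ℤP.+-assoc (f 0) _ _))

∏-split : ∀ a b (f : ℕ → ℤ) → ∏ (a +ℕ b) f ≡ ∏ a f * ∏ b (λ i → f (a +ℕ i))
∏-split zero b f = sym (ℤP.*-identityˡ _)
∏-split (suc a) b f = trans (cong (f 0 *_) (∏-split a b _)) (sym (ℤP.*-assoc (f 0) _ _))

∑-const : ∀ n c → ∑ n (λ _ → c) ≡ + n * c
∑-const zero c = refl
∑-const (suc n) c = trans (cong (_+_ c) (∑-const n c)) (sym (ℤP.suc-* (+ n) c))

∏-const : ∀ k c → ∏ k (λ _ → + c) ≡ + (c ^ k)
∏-const zero c = refl
∏-const (suc k) c = trans (cong (+ c *_) (∏-const k c)) (sym (ℤP.pos-* c (c ^ k)))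

∏-1 : ∀ n → ∏ n (λ _ → 1ℤ) ≡ 1ℤ
∏-1 n = trans (∏-const n 1) (cong +_ (ℕP.^-zeroˡ n))

∏-zero : ∀ n (f : ℕ → ℤ) i → i <ℕ n → f i ≡ 0ℤ → ∏ n f ≡ 0ℤ
∏-zero (suc n) f zero _ e = cong (_* ∏ n (λ i → f (suc i))) e
∏-zero (suc n) f (suc i) (s≤s lt) e = trans (cong (f 0 *_) (∏-zero n (λ i → f (suc i)) i lt e)) (ℤP.*-zeroʳ (f 0))

∏-single : ∀ n (f : ℕ → ℤ) A → A <ℕ n → ∏ n (λ i → if i ≡ᵇ A then f i else 1ℤ) ≡ f A
∏-single (suc n) f zero _ = trans (cong (f 0 *_) (∏-1 n)) (ℤP.*-identityʳ (f 0))
∏-single (suc n) f (suc A) (s≤s lt) = trans (ℤP.*-identityˡ _) (∏-single n (λ i → f (suc i)) A lt)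

χ : Bool → ℤ
χ true = 1ℤ
χ false = 0ℤ

χ-∧ : ∀ a b → χ (a ∧ b) ≡ χ a * χ b
χ-∧ true b = sym (ℤP.*-identityˡ _)
χ-∧ false b = refl

T-∧-intro : ∀ {a b} → T a → T b → T (a ∧ b)
T-∧-intro p q = Equivalence.from BP.T-∧ (p , q)

T-∧-l : ∀ {a b} → T (a ∧ b) → T a
T-∧-l p = proj₁ (Equivalence.to BP.T-∧ p)

T-∧-r : ∀ {a b} → T (a ∧ b) → T b
T-∧-r {a} p = proj₂ (Equivalence.to (BP.T-∧ {a}) p)

T-injective : ∀ {a b} → (T a → T b) → (T b → T a) → a ≡ b
T-injective {true} {true} f g = refl
T-injective {true} {false} f g = ⊥-elim (f tt)
T-injective {false} {true} f g = ⊥-elim (g tt)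
T-injective {false} {false} f g = refl

¬T⇒false : ∀ {b} → ¬ T b → b ≡ false
¬T⇒false {true} p = ⊥-elim (p tt)
¬T⇒false {false} p = refl

≡⇒≡ᵇ-true : ∀ {x v} → x ≡ v → (x ≡ᵇ v) ≡ true
≡⇒≡ᵇ-true {x} {v} e = Equivalence.to BP.T-≡ (ℕP.≡⇒≡ᵇ x v e)

≡ᵇ-refl : ∀ x → (x ≡ᵇ x) ≡ true
≡ᵇ-refl x = ≡⇒≡ᵇ-true {x} refl

≢⇒≡ᵇ-false : ∀ {x v} → x ≢ v → (x ≡ᵇ v) ≡ false
≢⇒≡ᵇ-false {x} {v} ne = ¬T⇒false (λ t → ne (ℕP.≡ᵇ⇒≡ x v t))

≰⇒≤ᵇ-false : ∀ {m n} → ¬ (m ≤ℕ n) → (m ≤ᵇ n) ≡ false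
≰⇒≤ᵇ-false ¬p = ¬T⇒false (λ t → ¬p (ℕP.≤ᵇ⇒≤ _ _ t))

all< : ℕ → (ℕ → Bool) → Bool
all< zero f = true
all< (suc n) f = f 0 ∧ all< n (λ i → f (suc i))

all<-cong : ∀ n {f g : ℕ → Bool} → (∀ i → i <ℕ n → f i ≡ g i) → all< n f ≡ all< n g
all<-cong zero h = refl
all<-cong (suc n) h = cong₂ _∧_ (h 0 (s≤s z≤n)) (all<-cong n (λ i lt → h (suc i) (s≤s lt)))

all<-elim : ∀ n f i → T (all< n f) → i <ℕ n → T (f i)
all<-elim (suc n) f zero p _ = T-∧-l p
all<-elim (suc n) f (suc i) p (s≤s lt) = all<-elim n (λ i → f (suc i)) i (T-∧-r {f 0} p) lt

all<-intro : ∀ n f → (∀ i → i <ℕ n → T (f i)) → T (all< n f)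
all<-intro zero f h = tt
all<-intro (suc n) f h = T-∧-intro (h 0 (s≤s z≤n)) (all<-intro n (λ i → f (suc i)) (λ i lt → h (suc i) (s≤s lt)))

sign : ℕ → ℤ
sign zero = 1ℤ
sign (suc zero) = - 1ℤ
sign (suc (suc n)) = sign n

isEven : ℕ → Bool
isEven zero = true
isEven (suc zero) = false
isEven (suc (suc n)) = isEven n

isEven-double : ∀ c → isEven (c +ℕ c) ≡ true
isEven-double zero = refl
isEven-double (suc c) rewrite ℕP.+-suc c c = isEven-double c

sign-+ : ∀ a b → sign (a +ℕ b) ≡ sign a * sign b
sign-+ zero b = sym (ℤP.*-identityˡ _)
sign-+ (suc zero) b = sign-suc b
  where
  sign-suc : ∀ n → sign (suc n) ≡ - 1ℤ * sign n
  sign-suc zero = refl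
  sign-suc (suc zero) = refl
  sign-suc (suc (suc n)) = sign-suc n
sign-+ (suc (suc a)) b = sign-+ a b

sign-sq : ∀ a → sign a * sign a ≡ 1ℤ
sign-sq zero = refl
sign-sq (suc zero) = refl
sign-sq (suc (suc a)) = sign-sq a

∑-sign-upTo : ∀ n → ∑ (suc n) sign ≡ χ (isEven n)
∑-sign-upTo zero = refl
∑-sign-upTo (suc zero) = refl
∑-sign-upTo (suc (suc n)) = trans (cancel (∑ (suc n) sign)) (∑-sign-upTo n)
  where
  cancel : ∀ x → 1ℤ + (- 1ℤ + x) ≡ x
  cancel = ZS.solve-∀

∑-sign-shift : ∀ n d → ∑ n (λ i → sign (d +ℕ i)) ≡ sign d * ∑ n sign
∑-sign-shift n d = trans (∑-cong n (λ i _ → sign-+ d i)) (∑-*ˡ n (sign d) sign)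

inInterval : ℕ → ℕ → ℕ → Bool
inInterval d e z = (d ≤ᵇ z) ∧ (z ≤ᵇ d +ℕ e)

∑-interval : ∀ n d e (g : ℕ → ℤ) → d +ℕ e <ℕ n → ∑ n (λ z → g z * χ (inInterval d e z)) ≡ ∑ (suc e) (λ i → g (d +ℕ i))
∑-interval n d e g lt with ℕP.m≤n⇒∃[o]m+o≡n lt
... | r , refl = begin
    ∑ (suc (d +ℕ e) +ℕ r) F
      ≡⟨ cong (λ k → ∑ k F) (regroup d e r) ⟩
    ∑ (d +ℕ (suc e +ℕ r)) F
      ≡⟨ ∑-split d (suc e +ℕ r) F ⟩
    ∑ d F + ∑ (suc e +ℕ r) (λ i → F (d +ℕ i))
      ≡⟨ cong₂ _+_ (∑-zero d below) (∑-split (suc e) r (λ i → F (d +ℕ i))) ⟩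
    0ℤ + (∑ (suc e) (λ i → F (d +ℕ i)) + ∑ r (λ i → F (d +ℕ (suc e +ℕ i))))
      ≡⟨ cong (λ z → 0ℤ + (∑ (suc e) (λ i → F (d +ℕ i)) + z)) (∑-zero r (λ i _ → above i)) ⟩
    0ℤ + (∑ (suc e) (λ i → F (d +ℕ i)) + 0ℤ)
      ≡⟨ trans (ℤP.+-identityˡ _) (ℤP.+-identityʳ _) ⟩
    ∑ (suc e) (λ i → F (d +ℕ i))
      ≡⟨ ∑-cong (suc e) inside ⟩
    ∑ (suc e) (λ i → g (d +ℕ i)) ∎
  where
  open ≡-Reasoning
  F : ℕ → ℤ
  F z = g z * χ (inInterval d e z)
  regroup : ∀ d e r → suc (d +ℕ e) +ℕ r ≡ d +ℕ (suc e +ℕ r)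
  regroup = NS.solve-∀
  below : ∀ i → i <ℕ d → F i ≡ 0ℤ
  below i i<d rewrite ≰⇒≤ᵇ-false (ℕP.<⇒≱ i<d) = ℤP.*-zeroʳ (g i)
  inside : ∀ i → i <ℕ suc e → F (d +ℕ i) ≡ g (d +ℕ i)
  inside i (s≤s i≤e) rewrite T-injective {inInterval d e (d +ℕ i)} {true} (λ _ → tt) (λ _ → T-∧-intro (ℕP.≤⇒≤ᵇ (ℕP.m≤m+n d i)) (ℕP.≤⇒≤ᵇ (ℕP.+-monoʳ-≤ d i≤e))) = ℤP.*-identityʳ _
  above : ∀ i → F (d +ℕ (suc e +ℕ i)) ≡ 0ℤ
  above i rewrite ≰⇒≤ᵇ-false {d +ℕ (suc e +ℕ i)} {d +ℕ e} (ℕP.<⇒≱ (ℕP.+-monoʳ-< d (ℕP.m≤m+n (suc e) i))) | BP.∧-zeroʳ (d ≤ᵇ d +ℕ (suc e +ℕ i)) = ℤP.*-zeroʳ (g (d +ℕ (suc e +ℕ i)))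

-- Out of range, lookupℕ returns the junk value 0.
lookupℕ : ∀ {m} → Vec ℕ m → ℕ → ℕ
lookupℕ [] i = 0
lookupℕ (x ∷ xs) zero = x
lookupℕ (x ∷ xs) (suc i) = lookupℕ xs i

lookupℕ-++ˡ : ∀ {a b} (u : Vec ℕ a) (v : Vec ℕ b) i → i <ℕ a → lookupℕ (u Vec.++ v) i ≡ lookupℕ u i
lookupℕ-++ˡ (x ∷ u) v zero _ = refl
lookupℕ-++ˡ (x ∷ u) v (suc i) (s≤s lt) = lookupℕ-++ˡ u v i lt

lookupℕ-++ʳ : ∀ {a b} (u : Vec ℕ a) (v : Vec ℕ b) j → lookupℕ (u Vec.++ v) (a +ℕ j) ≡ lookupℕ v j
lookupℕ-++ʳ [] v j = refl
lookupℕ-++ʳ (x ∷ u) v j = lookupℕ-++ʳ u v j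

module VectorSum (N : ℕ) where

  Bounded : ∀ {m} → Vec ℕ m → Set
  Bounded = All (_<ℕ N)

  ∑ᵥ : (m : ℕ) → (Vec ℕ m → ℤ) → ℤ
  ∑ᵥ zero F = F []
  ∑ᵥ (suc m) F = ∑ N (λ x → ∑ᵥ m (λ v → F (x ∷ v)))

  ∑ᵥ-cong : ∀ m {F G : Vec ℕ m → ℤ} → (∀ v → Bounded v → F v ≡ G v) → ∑ᵥ m F ≡ ∑ᵥ m G
  ∑ᵥ-cong zero h = h [] []
  ∑ᵥ-cong (suc m) h = ∑-cong N (λ x x<N → ∑ᵥ-cong m (λ v bv → h (x ∷ v) (x<N ∷ bv)))

  ∑ᵥ-*ˡ : ∀ m c (F : Vec ℕ m → ℤ) → ∑ᵥ m (λ v → c * F v) ≡ c * ∑ᵥ m F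
  ∑ᵥ-*ˡ zero c F = refl
  ∑ᵥ-*ˡ (suc m) c F = trans (∑-cong N (λ x _ → ∑ᵥ-*ˡ m c _)) (∑-*ˡ N c _)

  ∑-∑ᵥ-comm : ∀ m (F : ℕ → Vec ℕ m → ℤ) → ∑ N (λ x → ∑ᵥ m (F x)) ≡ ∑ᵥ m (λ v → ∑ N (λ x → F x v))
  ∑-∑ᵥ-comm zero F = refl
  ∑-∑ᵥ-comm (suc m) F = trans (∑-comm N N _) (∑-cong N (λ y _ → ∑-∑ᵥ-comm m (λ x v → F x (y ∷ v))))

  ∑ᵥ-++ : ∀ a b (F : Vec ℕ (a +ℕ b) → ℤ) → ∑ᵥ (a +ℕ b) F ≡ ∑ᵥ a (λ u → ∑ᵥ b (λ v → F (u Vec.++ v)))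
  ∑ᵥ-++ zero b F = refl
  ∑ᵥ-++ (suc a) b F = ∑-cong N (λ x _ → ∑ᵥ-++ a b (λ w → F (x ∷ w)))

  ∑ᵥ-all< : ∀ k (F : ℕ → ℕ → Bool) → ∑ᵥ k (λ y → χ (all< k (λ j → F j (lookupℕ y j)))) ≡ ∏ k (λ j → ∑ N (λ z → χ (F j z)))
  ∑ᵥ-all< zero F = refl
  ∑ᵥ-all< (suc k) F = trans (∑-cong N (λ z0 _ → trans (∑ᵥ-cong k (λ ys _ → χ-∧ (F 0 z0) (all< k (λ j → F (suc j) (lookupℕ ys j)))))
                                         (trans (∑ᵥ-*ˡ k (χ (F 0 z0)) (λ ys → χ (all< k (λ j → F (suc j) (lookupℕ ys j)))))
                                           (cong (χ (F 0 z0) *_) (∑ᵥ-all< k (λ j → F (suc j)))))))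
                          (∑-*ʳ N _ (λ z0 → χ (F 0 z0)))

-- Admissible triples

-- Throughout, t = 2H and N = H + 1: sums over ℕ run over z < N, i.e. over 0 ≤ z ≤ H.
module Admissibility (H : ℕ) where
  N : ℕ
  N = suc H

  t : ℕ
  t = H +ℕ H

  <N⇒≤H : ∀ {x} → x <ℕ N → x ≤ℕ H
  <N⇒≤H (s≤s p) = p

  Admissible : ℕ → ℕ → ℕ → Set
  Admissible x y z = (x ≤ℕ y +ℕ z) × (y ≤ℕ x +ℕ z) × (z ≤ℕ x +ℕ y) × (x +ℕ y +ℕ z ≤ℕ t)

  admissible? : ∀ x y z → Dec (Admissible x y z)
  admissible? x y z = x ℕ.≤? y +ℕ z ×-dec y ℕ.≤? x +ℕ z ×-dec z ℕ.≤? x +ℕ y ×-dec x +ℕ y +ℕ z ℕ.≤? t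

  admissibleᵇ : ℕ → ℕ → ℕ → Bool
  admissibleᵇ x y z = ⌊ admissible? x y z ⌋

  admissibleᵇ⇒Admissible : ∀ {x y z} → T (admissibleᵇ x y z) → Admissible x y z
  admissibleᵇ⇒Admissible {x} {y} {z} = toWitness {a? = admissible? x y z}

  Admissible⇒admissibleᵇ : ∀ {x y z} → Admissible x y z → T (admissibleᵇ x y z)
  Admissible⇒admissibleᵇ {x} {y} {z} = fromWitness {a? = admissible? x y z}

  admissibleᵇ-cong : ∀ {x y z x′ y′ z′} → (Admissible x y z → Admissible x′ y′ z′) → (Admissible x′ y′ z′ → Admissible x y z) →
                     admissibleᵇ x y z ≡ admissibleᵇ x′ y′ z′
  admissibleᵇ-cong to from = T-injective (λ p → Admissible⇒admissibleᵇ (to (admissibleᵇ⇒Admissible p))) (λ p → Admissible⇒admissibleᵇ (from (admissibleᵇ⇒Admissible p)))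

  Admissible-swap : ∀ {x y z} → Admissible x y z → Admissible y x z
  Admissible-swap {x} {y} {z} (a , b , c , d) = b , a , subst (z ≤ℕ_) (ℕP.+-comm x y) c , subst (_≤ℕ t) (cong (_+ℕ z) (ℕP.+-comm x y)) d

  Admissible-swap₂₃ : ∀ {x y z} → Admissible x y z → Admissible x z y
  Admissible-swap₂₃ {x} {y} {z} (a , b , c , d) = subst (x ≤ℕ_) (ℕP.+-comm y z) a , c , b , subst (_≤ℕ t) (permute x y z) d
    where
    permute : ∀ x y z → x +ℕ y +ℕ z ≡ x +ℕ z +ℕ y
    permute = NS.solve-∀

  admissibleᵇ-swap : ∀ x y z → admissibleᵇ x y z ≡ admissibleᵇ y x z
  admissibleᵇ-swap x y z = admissibleᵇ-cong Admissible-swap Admissible-swap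

  admissibleᵇ-swap₂₃ : ∀ x y z → admissibleᵇ x y z ≡ admissibleᵇ x z y
  admissibleᵇ-swap₂₃ x y z = admissibleᵇ-cong Admissible-swap₂₃ Admissible-swap₂₃

  admissibleᵇ-rotate : ∀ x y z → admissibleᵇ x y z ≡ admissibleᵇ y z x
  admissibleᵇ-rotate x y z = admissibleᵇ-cong (λ p → Admissible-swap₂₃ (Admissible-swap p)) (λ p → Admissible-swap (Admissible-swap₂₃ p))

  Admissible-≤H : ∀ {x y z} → Admissible x y z → x ≤ℕ H × y ≤ℕ H × z ≤ℕ H
  Admissible-≤H {x} {y} {z} (p , q , r , s) = half (ℕP.≤-trans (ℕP.+-monoʳ-≤ x p) (subst (_≤ℕ t) (ℕP.+-assoc x y z) s)) ,
     half (ℕP.≤-trans (ℕP.+-monoʳ-≤ y q) (subst (_≤ℕ t) (regroup₁ x y z) s)) ,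
     half (ℕP.≤-trans (ℕP.+-monoʳ-≤ z r) (subst (_≤ℕ t) (regroup₂ x y z) s))
    where
    regroup₁ : ∀ x y z → x +ℕ y +ℕ z ≡ y +ℕ (x +ℕ z)
    regroup₁ = NS.solve-∀
    regroup₂ : ∀ x y z → x +ℕ y +ℕ z ≡ z +ℕ (x +ℕ y)
    regroup₂ = NS.solve-∀
    half : ∀ {a} → a +ℕ a ≤ℕ H +ℕ H → a ≤ℕ H
    half {a} le with a ℕ.≤? H
    ... | Relation.Nullary.yes p = p
    ... | Relation.Nullary.no ¬p = ⊥-elim (ℕP.<⇒≱ (ℕP.+-mono-< (ℕP.≰⇒> ¬p) (ℕP.≰⇒> ¬p)) le)

  ∑-sign-evenInterval : ∀ (b : ℕ → Bool) d c → d +ℕ (c +ℕ c) ≤ℕ H →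
    (∀ z → T (b z) → d ≤ℕ z × z ≤ℕ d +ℕ (c +ℕ c)) → (∀ z → d ≤ℕ z → z ≤ℕ d +ℕ (c +ℕ c) → T (b z)) →
    ∑ N (λ z → sign z * χ (b z)) ≡ sign d
  ∑-sign-evenInterval b d c fits sub sup = begin
    ∑ N (λ z → sign z * χ (b z))
      ≡⟨ ∑-cong N (λ z _ → cong (λ q → sign z * χ q) (T-injective (to z) (from z))) ⟩
    ∑ N (λ z → sign z * χ (inInterval d (c +ℕ c) z))
      ≡⟨ ∑-interval N d (c +ℕ c) sign (s≤s fits) ⟩
    ∑ (suc (c +ℕ c)) (λ i → sign (d +ℕ i))
      ≡⟨ ∑-sign-shift (suc (c +ℕ c)) d ⟩
    sign d * ∑ (suc (c +ℕ c)) sign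
      ≡⟨ cong (sign d *_) (trans (∑-sign-upTo (c +ℕ c)) (cong χ (isEven-double c))) ⟩
    sign d * 1ℤ
      ≡⟨ ℤP.*-identityʳ _ ⟩
    sign d ∎
    where
    open ≡-Reasoning
    to : ∀ z → T (b z) → T (inInterval d (c +ℕ c) z)
    to z p = let (d≤z , z≤) = sub z p in T-∧-intro (ℕP.≤⇒≤ᵇ d≤z) (ℕP.≤⇒≤ᵇ z≤)
    from : ∀ z → T (inInterval d (c +ℕ c) z) → T (b z)
    from z p = sup z (ℕP.≤ᵇ⇒≤ _ _ (T-∧-l p)) (ℕP.≤ᵇ⇒≤ _ _ (T-∧-r p))

  min-cases : ∀ x r → ∃ λ c → c ≤ℕ x × c ≤ℕ r × (c ≡ x ⊎ c ≡ r)
  min-cases x r = x ⊓ r , ℕP.m⊓n≤m x r , ℕP.m⊓n≤n x r , ℕP.⊓-sel x r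

  -- For x ≤ y = x + d ≤ H = x + d + r the admissible z are those with d ≤ z ≤ d + 2 min(x, r).
  ∑-sign-admissible-≤ : ∀ x d → x +ℕ d ≤ℕ H → ∑ N (λ z → sign z * χ (admissibleᵇ x (x +ℕ d) z)) ≡ sign x * sign (x +ℕ d)
  ∑-sign-admissible-≤ x d le with ℕP.m≤n⇒∃[o]m+o≡n le
  ... | r , refl with min-cases x r
  ... | c , c≤x , c≤r , c≡ = trans (∑-sign-evenInterval (admissibleᵇ x (x +ℕ d)) d c fits sub sup) (sym sign-x-xd)
    where
    t≡ : t ≡ (x +ℕ (x +ℕ d)) +ℕ (d +ℕ (r +ℕ r))
    t≡ = expand x d r
      where
      expand : ∀ x d r → (x +ℕ d +ℕ r) +ℕ (x +ℕ d +ℕ r) ≡ (x +ℕ (x +ℕ d)) +ℕ (d +ℕ (r +ℕ r))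
      expand = NS.solve-∀
    regroup : ∀ x d → x +ℕ (x +ℕ d) ≡ d +ℕ (x +ℕ x)
    regroup = NS.solve-∀
    sub : ∀ z → T (admissibleᵇ x (x +ℕ d) z) → d ≤ℕ z × z ≤ℕ d +ℕ (c +ℕ c)
    sub z p with admissibleᵇ⇒Admissible p
    ... | _ , y≤x+z , z≤x+y , sum≤t = ℕP.+-cancelˡ-≤ x d z y≤x+z , upper c≡
      where
      upper : (c ≡ x ⊎ c ≡ r) → z ≤ℕ d +ℕ (c +ℕ c)
      upper (inj₁ refl) = subst (z ≤ℕ_) (regroup c d) z≤x+y
      upper (inj₂ refl) = ℕP.+-cancelˡ-≤ (x +ℕ (x +ℕ d)) z (d +ℕ (c +ℕ c)) (subst (x +ℕ (x +ℕ d) +ℕ z ≤ℕ_) t≡ sum≤t)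
    sup : ∀ z → d ≤ℕ z → z ≤ℕ d +ℕ (c +ℕ c) → T (admissibleᵇ x (x +ℕ d) z)
    sup z d≤z z≤ = Admissible⇒admissibleᵇ (ℕP.≤-trans (ℕP.m≤m+n x d) (ℕP.m≤m+n (x +ℕ d) z) , ℕP.+-monoʳ-≤ x d≤z ,
       ℕP.≤-trans z≤ (subst (d +ℕ (c +ℕ c) ≤ℕ_) (sym (regroup x d)) (ℕP.+-monoʳ-≤ d (ℕP.+-mono-≤ c≤x c≤x))) ,
       subst (x +ℕ (x +ℕ d) +ℕ z ≤ℕ_) (sym t≡) (ℕP.+-monoʳ-≤ (x +ℕ (x +ℕ d)) (ℕP.≤-trans z≤ (ℕP.+-monoʳ-≤ d (ℕP.+-mono-≤ c≤r c≤r)))))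
    fits : d +ℕ (c +ℕ c) ≤ℕ x +ℕ d +ℕ r
    fits = subst (d +ℕ (c +ℕ c) ≤ℕ_) (regroup′ x d r) (ℕP.+-monoʳ-≤ d (ℕP.+-mono-≤ c≤x c≤r))
      where
      regroup′ : ∀ x d r → d +ℕ (x +ℕ r) ≡ x +ℕ d +ℕ r
      regroup′ = NS.solve-∀
    sign-x-xd : sign x * sign (x +ℕ d) ≡ sign d
    sign-x-xd = begin
      sign x * sign (x +ℕ d)     ≡⟨ cong (sign x *_) (sign-+ x d) ⟩
      sign x * (sign x * sign d) ≡⟨ sym (ℤP.*-assoc (sign x) (sign x) (sign d)) ⟩
      sign x * sign x * sign d   ≡⟨ cong (_* sign d) (sign-sq x) ⟩
      1ℤ * sign d                ≡⟨ ℤP.*-identityˡ _ ⟩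
      sign d                     ∎
      where open ≡-Reasoning

  ∑-sign-admissible : ∀ x y → x ≤ℕ H → y ≤ℕ H → ∑ N (λ z → sign z * χ (admissibleᵇ x y z)) ≡ sign x * sign y
  ∑-sign-admissible x y xH yH with ℕP.≤-total x y
  ... | inj₁ x≤y with ℕP.m≤n⇒∃[o]m+o≡n x≤y
  ... | d , refl = ∑-sign-admissible-≤ x d yH
  ∑-sign-admissible x y xH yH | inj₂ y≤x with ℕP.m≤n⇒∃[o]m+o≡n y≤x
  ... | d , refl = trans (∑-cong N (λ z _ → cong (λ b → sign z * χ b) (admissibleᵇ-swap (y +ℕ d) y z))) (trans (∑-sign-admissible-≤ y d xH) (ℤP.*-comm (sign y) _))

  ∑-scaled-sign-admissible : ∀ c x y → x ≤ℕ H → y ≤ℕ H → ∑ N (λ z → c * (sign z * χ (admissibleᵇ x y z))) ≡ c * (sign x * sign y)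
  ∑-scaled-sign-admissible c x y xH yH = trans (∑-*ˡ N c (λ z → sign z * χ (admissibleᵇ x y z))) (cong (c *_) (∑-sign-admissible x y xH yH))

  loopCount : ℕ → ℤ
  loopCount x = ∑ N (λ y → χ (admissibleᵇ x y y))

  -- For y ≤ H = y + r the x with (x, y, y) admissible are 0 ≤ x ≤ 2 min(y, r).
  ∑-sign-admissible-loop : ∀ y → y ≤ℕ H → ∑ N (λ x → sign x * χ (admissibleᵇ x y y)) ≡ 1ℤ
  ∑-sign-admissible-loop y yH with ℕP.m≤n⇒∃[o]m+o≡n yH
  ... | r , refl with min-cases y r
  ... | c , c≤y , c≤r , c≡ = ∑-sign-evenInterval (λ x → admissibleᵇ x y y) 0 c (ℕP.+-mono-≤ c≤y c≤r) sub sup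
    where
    t≡ : t ≡ (y +ℕ y) +ℕ (r +ℕ r)
    t≡ = expand y r
      where
      expand : ∀ y r → (y +ℕ r) +ℕ (y +ℕ r) ≡ (y +ℕ y) +ℕ (r +ℕ r)
      expand = NS.solve-∀
    regroup : ∀ x y → x +ℕ y +ℕ y ≡ (y +ℕ y) +ℕ x
    regroup = NS.solve-∀
    sub : ∀ x → T (admissibleᵇ x y y) → 0 ≤ℕ x × x ≤ℕ c +ℕ c
    sub x p with admissibleᵇ⇒Admissible p
    ... | x≤y+y , _ , _ , sum≤t = z≤n , upper c≡
      where
      upper : (c ≡ y ⊎ c ≡ r) → x ≤ℕ c +ℕ c
      upper (inj₁ refl) = x≤y+y
      upper (inj₂ refl) = ℕP.+-cancelˡ-≤ (y +ℕ y) x (c +ℕ c) (subst₂ _≤ℕ_ (regroup x y) t≡ sum≤t)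
    sup : ∀ x → 0 ≤ℕ x → x ≤ℕ c +ℕ c → T (admissibleᵇ x y y)
    sup x _ x≤ = Admissible⇒admissibleᵇ (ℕP.≤-trans x≤ (ℕP.+-mono-≤ c≤y c≤y) , ℕP.m≤n+m y x , ℕP.m≤n+m y x ,
        subst₂ _≤ℕ_ (sym (regroup x y)) (sym t≡) (ℕP.+-monoʳ-≤ (y +ℕ y) (ℕP.≤-trans x≤ (ℕP.+-mono-≤ c≤r c≤r))))

  signed-loopCount : ∑ N (λ x → sign x * loopCount x) ≡ + N
  signed-loopCount = begin
    ∑ N (λ x → sign x * loopCount x)
      ≡⟨ ∑-cong N (λ x _ → sym (∑-*ˡ N (sign x) (λ y → χ (admissibleᵇ x y y)))) ⟩
    ∑ N (λ x → ∑ N (λ y → sign x * χ (admissibleᵇ x y y)))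
      ≡⟨ ∑-comm N N (λ x y → sign x * χ (admissibleᵇ x y y)) ⟩
    ∑ N (λ y → ∑ N (λ x → sign x * χ (admissibleᵇ x y y)))
      ≡⟨ ∑-cong N (λ y y<N → ∑-sign-admissible-loop y (<N⇒≤H y<N)) ⟩
    ∑ N (λ _ → 1ℤ)
      ≡⟨ ∑-const N 1ℤ ⟩
    + N * 1ℤ
      ≡⟨ ℤP.*-identityʳ _ ⟩
    + N ∎
    where open ≡-Reasoning

-- Summing out a caterpillar

∏-legs : ∀ {n} → (ℕ → ℕ → ℤ) → Vec ℕ n → ℤ
∏-legs ℓ [] = 1ℤ
∏-legs ℓ (x ∷ xs) = ℓ 0 x * ∏-legs (λ i → ℓ (suc i)) xs

∏-legs≡∏ : ∀ {n} (ℓ : ℕ → ℕ → ℤ) (x : Vec ℕ n) → ∏-legs ℓ x ≡ ∏ n (λ i → ℓ i (lookupℕ x i))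
∏-legs≡∏ ℓ [] = refl
∏-legs≡∏ ℓ (x ∷ xs) = cong (ℓ 0 x *_) (∏-legs≡∏ (λ i → ℓ (suc i)) xs)


-- A caterpillar with legs x₀, …, x_{m+2} and central path p₀, …, p_{m−1} has the nodes
-- (x₀, x₁, p₀), (p_{i−1}, x_{i+1}, p_i) and (p_{m−1}, x_{m+1}, x_{m+2}); chainSum m ℓ weighs
-- leg i by ℓ i and sums over all admissible labellings with entries ≤ H.
module Caterpillar (H : ℕ) where
  open Admissibility H
  open VectorSum N

  chainAdmissibleᵇ : ∀ m → Vec ℕ (3 +ℕ m) → Vec ℕ m → Bool
  chainAdmissibleᵇ zero (x0 ∷ x1 ∷ x2 ∷ []) [] = admissibleᵇ x0 x1 x2
  chainAdmissibleᵇ (suc m) (x0 ∷ x1 ∷ xs) (p0 ∷ ps) = admissibleᵇ x0 x1 p0 ∧ chainAdmissibleᵇ m (p0 ∷ xs) ps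

  chainSum : ∀ m → (ℕ → ℕ → ℤ) → ℤ
  chainSum m ℓ = ∑ᵥ (3 +ℕ m) (λ x → ∑ᵥ m (λ p → ∏-legs ℓ x * χ (chainAdmissibleᵇ m x p)))

  signed : (ℕ → ℤ) → ℤ
  signed f = ∑ N (λ z → sign z * f z)

  ∏-signed-except : ∀ n → (ℕ → ℕ → ℤ) → Fin n → ℤ
  ∏-signed-except (suc n) ℓ zero = ∏ n (λ i → signed (ℓ (suc i)))
  ∏-signed-except (suc n) ℓ (suc a) = signed (ℓ 0) * ∏-signed-except n (λ i → ℓ (suc i)) a

  ∏-signed-except≡∏ : ∀ n ℓ (a : Fin n) → ∏-signed-except n ℓ a ≡ ∏ n (λ i → if i ≡ᵇ toℕ a then 1ℤ else signed (ℓ i))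
  ∏-signed-except≡∏ (suc n) ℓ zero = sym (ℤP.*-identityˡ _)
  ∏-signed-except≡∏ (suc n) ℓ (suc a) = cong (signed (ℓ 0) *_) (∏-signed-except≡∏ n (λ i → ℓ (suc i)) a)

  ∏-legs-cong : ∀ {n} {ℓ ℓ′ : ℕ → ℕ → ℤ} → (∀ i z → z ≤ℕ H → ℓ i z ≡ ℓ′ i z) → {x : Vec ℕ n} → Bounded x → ∏-legs ℓ x ≡ ∏-legs ℓ′ x
  ∏-legs-cong eq [] = refl
  ∏-legs-cong eq (x<N ∷ bx) = cong₂ _*_ (eq 0 _ (<N⇒≤H x<N)) (∏-legs-cong (λ i → eq (suc i)) bx)

  chainSum-cong : ∀ m {ℓ ℓ′ : ℕ → ℕ → ℤ} → (∀ i z → z ≤ℕ H → ℓ i z ≡ ℓ′ i z) → chainSum m ℓ ≡ chainSum m ℓ′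
  chainSum-cong m eq = ∑ᵥ-cong (3 +ℕ m) (λ x bx → ∑ᵥ-cong m (λ p _ → cong (_* χ (chainAdmissibleᵇ m x p)) (∏-legs-cong eq bx)))

  scaleFirstLeg : ℤ → (ℕ → ℕ → ℤ) → ℕ → ℕ → ℤ
  scaleFirstLeg c ℓ zero z = c * ℓ 0 z
  scaleFirstLeg c ℓ (suc i) = ℓ (suc i)

  chainSum-scaleFirstLeg : ∀ m c ℓ → chainSum m (scaleFirstLeg c ℓ) ≡ c * chainSum m ℓ
  chainSum-scaleFirstLeg m c ℓ = trans (∑ᵥ-cong (3 +ℕ m) (λ x _ → trans (∑ᵥ-cong m (λ p _ → pull x p)) (∑ᵥ-*ˡ m c (λ p → ∏-legs ℓ x * χ (chainAdmissibleᵇ m x p))))) (∑ᵥ-*ˡ (3 +ℕ m) c (λ x → ∑ᵥ m (λ p → ∏-legs ℓ x * χ (chainAdmissibleᵇ m x p))))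
    where
    pull : ∀ x p → ∏-legs (scaleFirstLeg c ℓ) x * χ (chainAdmissibleᵇ m x p) ≡ c * (∏-legs ℓ x * χ (chainAdmissibleᵇ m x p))
    pull (x0 ∷ xs) p = trans (cong (_* χ (chainAdmissibleᵇ m (x0 ∷ xs) p)) (ℤP.*-assoc c (ℓ 0 x0) _)) (ℤP.*-assoc c _ _)

  signed-pair : ∀ f g → ∑ N (λ x → ∑ N (λ y → ∑ N (λ z → sign z * (f x * (g y * χ (admissibleᵇ x y z)))))) ≡ signed f * signed g
  signed-pair f g = begin
    ∑ N (λ x → ∑ N (λ y → ∑ N (λ z → sign z * (f x * (g y * χ (admissibleᵇ x y z))))))
      ≡⟨ ∑-cong N (λ x x<N → ∑-cong N (λ y y<N → trans (∑-cong N (λ z _ → regroup (sign z) (f x) (g y) (χ (admissibleᵇ x y z)))) (∑-scaled-sign-admissible (f x * g y) x y (<N⇒≤H x<N) (<N⇒≤H y<N)))) ⟩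
    ∑ N (λ x → ∑ N (λ y → (f x * g y) * (sign x * sign y)))
      ≡⟨ ∑-cong N (λ x _ → trans (∑-cong N (λ y _ → separate (f x) (g y) (sign x) (sign y))) (∑-*ˡ N (sign x * f x) (λ y → sign y * g y))) ⟩
    ∑ N (λ x → (sign x * f x) * signed g)
      ≡⟨ ∑-*ʳ N (signed g) (λ x → sign x * f x) ⟩
    signed f * signed g ∎
    where
    open ≡-Reasoning
    regroup : ∀ s a b c → s * (a * (b * c)) ≡ (a * b) * (s * c)
    regroup = ZS.solve-∀
    separate : ∀ a b s u → (a * b) * (s * u) ≡ (s * a) * (u * b)
    separate = ZS.solve-∀

  mergeFirstLegs : (ℕ → ℕ → ℤ) → ℕ → ℕ → ℤ
  mergeFirstLegs ℓ zero p = ∑ N (λ x0 → ∑ N (λ x1 → ℓ 0 x0 * (ℓ 1 x1 * χ (admissibleᵇ x0 x1 p))))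
  mergeFirstLegs ℓ (suc i) = ℓ (suc (suc i))

  ∑-firstNode-inward : ∀ m (G : ℕ → ℕ → ℕ → Vec ℕ (2 +ℕ m) → Vec ℕ m → ℤ) →
    ∑ N (λ p0 → ∑ᵥ (2 +ℕ m) (λ xs → ∑ᵥ m (λ ps → ∑ N (λ x0 → ∑ N (λ x1 → G x0 x1 p0 xs ps))))) ≡
    ∑ N (λ x0 → ∑ N (λ x1 → ∑ᵥ (2 +ℕ m) (λ xs → ∑ N (λ p0 → ∑ᵥ m (λ ps → G x0 x1 p0 xs ps)))))
  ∑-firstNode-inward m G = begin
      ∑ N (λ p0 → ∑ᵥ (2 +ℕ m) (λ xs → ∑ᵥ m (λ ps → ∑ N (λ x0 → ∑ N (λ x1 → G x0 x1 p0 xs ps)))))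
      ≡⟨ ∑-cong N (λ p0 _ → ∑ᵥ-cong (2 +ℕ m) (λ xs _ → sym (∑-∑ᵥ-comm m (λ x0 ps → ∑ N (λ x1 → G x0 x1 p0 xs ps))))) ⟩
    ∑ N (λ p0 → ∑ᵥ (2 +ℕ m) (λ xs → ∑ N (λ x0 → ∑ᵥ m (λ ps → ∑ N (λ x1 → G x0 x1 p0 xs ps)))))
      ≡⟨ ∑-cong N (λ p0 _ → ∑ᵥ-cong (2 +ℕ m) (λ xs _ → ∑-cong N (λ x0 _ → sym (∑-∑ᵥ-comm m (λ x1 ps → G x0 x1 p0 xs ps))))) ⟩
    ∑ N (λ p0 → ∑ᵥ (2 +ℕ m) (λ xs → ∑ N (λ x0 → ∑ N (λ x1 → ∑ᵥ m (λ ps → G x0 x1 p0 xs ps)))))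
      ≡⟨ ∑-cong N (λ p0 _ → sym (∑-∑ᵥ-comm (2 +ℕ m) (λ x0 xs → ∑ N (λ x1 → ∑ᵥ m (λ ps → G x0 x1 p0 xs ps))))) ⟩
    ∑ N (λ p0 → ∑ N (λ x0 → ∑ᵥ (2 +ℕ m) (λ xs → ∑ N (λ x1 → ∑ᵥ m (λ ps → G x0 x1 p0 xs ps)))))
      ≡⟨ ∑-cong N (λ p0 _ → ∑-cong N (λ x0 _ → sym (∑-∑ᵥ-comm (2 +ℕ m) (λ x1 xs → ∑ᵥ m (λ ps → G x0 x1 p0 xs ps))))) ⟩
    ∑ N (λ p0 → ∑ N (λ x0 → ∑ N (λ x1 → ∑ᵥ (2 +ℕ m) (λ xs → ∑ᵥ m (λ ps → G x0 x1 p0 xs ps)))))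
      ≡⟨ ∑-comm N N (λ p0 x0 → ∑ N (λ x1 → ∑ᵥ (2 +ℕ m) (λ xs → ∑ᵥ m (λ ps → G x0 x1 p0 xs ps)))) ⟩
    ∑ N (λ x0 → ∑ N (λ p0 → ∑ N (λ x1 → ∑ᵥ (2 +ℕ m) (λ xs → ∑ᵥ m (λ ps → G x0 x1 p0 xs ps)))))
      ≡⟨ ∑-cong N (λ x0 _ → ∑-comm N N (λ p0 x1 → ∑ᵥ (2 +ℕ m) (λ xs → ∑ᵥ m (λ ps → G x0 x1 p0 xs ps)))) ⟩
    ∑ N (λ x0 → ∑ N (λ x1 → ∑ N (λ p0 → ∑ᵥ (2 +ℕ m) (λ xs → ∑ᵥ m (λ ps → G x0 x1 p0 xs ps)))))
      ≡⟨ ∑-cong N (λ x0 _ → ∑-cong N (λ x1 _ → ∑-∑ᵥ-comm (2 +ℕ m) (λ p0 xs → ∑ᵥ m (λ ps → G x0 x1 p0 xs ps)))) ⟩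
    ∑ N (λ x0 → ∑ N (λ x1 → ∑ᵥ (2 +ℕ m) (λ xs → ∑ N (λ p0 → ∑ᵥ m (λ ps → G x0 x1 p0 xs ps))))) ∎
    where open ≡-Reasoning

  chainSum-merge : ∀ m ℓ → chainSum (suc m) ℓ ≡ chainSum m (mergeFirstLegs ℓ)
  chainSum-merge m ℓ = sym (trans (∑-cong N (λ p0 _ → ∑ᵥ-cong (2 +ℕ m) (λ xs _ → ∑ᵥ-cong m (λ ps _ → expand p0 xs ps)))) (∑-firstNode-inward m G))
    where
    P : Vec ℕ (2 +ℕ m) → ℤ
    P xs = ∏-legs (λ i → ℓ (suc (suc i))) xs
    C : ℕ → Vec ℕ (2 +ℕ m) → Vec ℕ m → Bool
    C p0 xs ps = chainAdmissibleᵇ m (p0 ∷ xs) ps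
    G : ℕ → ℕ → ℕ → Vec ℕ (2 +ℕ m) → Vec ℕ m → ℤ
    G x0 x1 p0 xs ps = (ℓ 0 x0 * (ℓ 1 x1 * P xs)) * χ (admissibleᵇ x0 x1 p0 ∧ C p0 xs ps)
    regroup : ∀ a b c p q → (a * (b * c)) * p * q ≡ (a * (b * p)) * (c * q)
    regroup = ZS.solve-∀
    expand : ∀ p0 xs ps → (mergeFirstLegs ℓ 0 p0 * P xs) * χ (C p0 xs ps) ≡ ∑ N (λ x0 → ∑ N (λ x1 → G x0 x1 p0 xs ps))
    expand p0 xs ps = begin
      (mergeFirstLegs ℓ 0 p0 * P xs) * χ (C p0 xs ps)
        ≡⟨ cong (_* χ (C p0 xs ps)) (sym (∑-*ʳ N (P xs) (λ x0 → ∑ N (λ x1 → ℓ 0 x0 * (ℓ 1 x1 * χ (admissibleᵇ x0 x1 p0)))))) ⟩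
      ∑ N (λ x0 → ∑ N (λ x1 → ℓ 0 x0 * (ℓ 1 x1 * χ (admissibleᵇ x0 x1 p0))) * P xs) * χ (C p0 xs ps)
        ≡⟨ sym (∑-*ʳ N (χ (C p0 xs ps)) (λ x0 → ∑ N (λ x1 → ℓ 0 x0 * (ℓ 1 x1 * χ (admissibleᵇ x0 x1 p0))) * P xs)) ⟩
      ∑ N (λ x0 → ∑ N (λ x1 → ℓ 0 x0 * (ℓ 1 x1 * χ (admissibleᵇ x0 x1 p0))) * P xs * χ (C p0 xs ps))
        ≡⟨ ∑-cong N (λ x0 _ → trans (cong (_* χ (C p0 xs ps)) (sym (∑-*ʳ N (P xs) (λ x1 → ℓ 0 x0 * (ℓ 1 x1 * χ (admissibleᵇ x0 x1 p0)))))) (sym (∑-*ʳ N (χ (C p0 xs ps)) (λ x1 → ℓ 0 x0 * (ℓ 1 x1 * χ (admissibleᵇ x0 x1 p0)) * P xs)))) ⟩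
      ∑ N (λ x0 → ∑ N (λ x1 → ℓ 0 x0 * (ℓ 1 x1 * χ (admissibleᵇ x0 x1 p0)) * P xs * χ (C p0 xs ps)))
        ≡⟨ ∑-cong N (λ x0 _ → ∑-cong N (λ x1 _ → trans (regroup (ℓ 0 x0) (ℓ 1 x1) (χ (admissibleᵇ x0 x1 p0)) (P xs) (χ (C p0 xs ps))) (cong (ℓ 0 x0 * (ℓ 1 x1 * P xs) *_) (sym (χ-∧ (admissibleᵇ x0 x1 p0) (C p0 xs ps)))))) ⟩
      ∑ N (λ x0 → ∑ N (λ x1 → G x0 x1 p0 xs ps)) ∎
      where open ≡-Reasoning

  signed-mergeFirstLegs : ∀ ℓ → signed (mergeFirstLegs ℓ 0) ≡ signed (ℓ 0) * signed (ℓ 1)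
  signed-mergeFirstLegs ℓ = begin
    ∑ N (λ z → sign z * ∑ N (λ x0 → ∑ N (λ x1 → F x0 x1 z)))
      ≡⟨ ∑-cong N (λ z _ → trans (sym (∑-*ˡ N (sign z) (λ x0 → ∑ N (λ x1 → F x0 x1 z)))) (∑-cong N (λ x0 _ → sym (∑-*ˡ N (sign z) (λ x1 → F x0 x1 z))))) ⟩
    ∑ N (λ z → ∑ N (λ x0 → ∑ N (λ x1 → sign z * F x0 x1 z)))
      ≡⟨ ∑-comm N N (λ z x0 → ∑ N (λ x1 → sign z * F x0 x1 z)) ⟩
    ∑ N (λ x0 → ∑ N (λ z → ∑ N (λ x1 → sign z * F x0 x1 z)))
      ≡⟨ ∑-cong N (λ x0 _ → ∑-comm N N (λ z x1 → sign z * F x0 x1 z)) ⟩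
    ∑ N (λ x0 → ∑ N (λ x1 → ∑ N (λ z → sign z * F x0 x1 z)))
      ≡⟨ signed-pair (ℓ 0) (ℓ 1) ⟩
    signed (ℓ 0) * signed (ℓ 1) ∎
    where
    open ≡-Reasoning
    F : ℕ → ℕ → ℕ → ℤ
    F x0 x1 z = ℓ 0 x0 * (ℓ 1 x1 * χ (admissibleᵇ x0 x1 z))

  -- Summing out x₀ against the sign leaves sign x₁ · sign p (admissibility is symmetric).
  mergeFirstLegs-sign : ∀ ℓ → (∀ z → ℓ 0 z ≡ sign z) → ∀ p → p ≤ℕ H → mergeFirstLegs ℓ 0 p ≡ signed (ℓ 1) * sign p
  mergeFirstLegs-sign ℓ h p p≤H = begin
    ∑ N (λ x0 → ∑ N (λ x1 → ℓ 0 x0 * (ℓ 1 x1 * χ (admissibleᵇ x0 x1 p))))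
      ≡⟨ ∑-comm N N (λ x0 x1 → ℓ 0 x0 * (ℓ 1 x1 * χ (admissibleᵇ x0 x1 p))) ⟩
    ∑ N (λ x1 → ∑ N (λ x0 → ℓ 0 x0 * (ℓ 1 x1 * χ (admissibleᵇ x0 x1 p))))
      ≡⟨ ∑-cong N (λ x1 x1<N → trans (∑-cong N (λ x0 _ → rotate x0 x1)) (∑-scaled-sign-admissible (ℓ 1 x1) x1 p (<N⇒≤H x1<N) p≤H)) ⟩
    ∑ N (λ x1 → ℓ 1 x1 * (sign x1 * sign p))
      ≡⟨ ∑-cong N (λ x1 _ → regroup (ℓ 1 x1) (sign x1) (sign p)) ⟩
    ∑ N (λ x1 → sign x1 * ℓ 1 x1 * sign p)
      ≡⟨ ∑-*ʳ N (sign p) (λ x1 → sign x1 * ℓ 1 x1) ⟩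
    signed (ℓ 1) * sign p ∎
    where
    open ≡-Reasoning
    exchange : ∀ a b c → a * (b * c) ≡ b * (a * c)
    exchange = ZS.solve-∀
    regroup : ∀ a b c → a * (b * c) ≡ b * a * c
    regroup = ZS.solve-∀
    rotate : ∀ x0 x1 → ℓ 0 x0 * (ℓ 1 x1 * χ (admissibleᵇ x0 x1 p)) ≡ ℓ 1 x1 * (sign x0 * χ (admissibleᵇ x1 p x0))
    rotate x0 x1 rewrite h x0 | admissibleᵇ-rotate x0 x1 p = exchange (sign x0) (ℓ 1 x1) _

  contractFirstLegs : (ℕ → ℕ → ℤ) → ℕ → ℕ → ℤ
  contractFirstLegs ℓ zero = sign
  contractFirstLegs ℓ (suc i) = ℓ (suc (suc i))

  chainSum-contract : ∀ m ℓ → (∀ z → ℓ 0 z ≡ sign z) → chainSum (suc m) ℓ ≡ signed (ℓ 1) * chainSum m (contractFirstLegs ℓ)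
  chainSum-contract m ℓ h = begin
    chainSum (suc m) ℓ
      ≡⟨ chainSum-merge m ℓ ⟩
    chainSum m (mergeFirstLegs ℓ)
      ≡⟨ chainSum-cong m merged ⟩
    chainSum m (scaleFirstLeg (signed (ℓ 1)) (contractFirstLegs ℓ))
      ≡⟨ chainSum-scaleFirstLeg m (signed (ℓ 1)) (contractFirstLegs ℓ) ⟩
    signed (ℓ 1) * chainSum m (contractFirstLegs ℓ) ∎
    where
    open ≡-Reasoning
    merged : ∀ i z → z ≤ℕ H → mergeFirstLegs ℓ i z ≡ scaleFirstLeg (signed (ℓ 1)) (contractFirstLegs ℓ) i z
    merged zero z z≤H = mergeFirstLegs-sign ℓ h z z≤H
    merged (suc i) z _ = refl

  swapLegs₀₁ : (ℕ → ℕ → ℤ) → ℕ → ℕ → ℤ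
  swapLegs₀₁ ℓ zero = ℓ 1
  swapLegs₀₁ ℓ (suc zero) = ℓ 0
  swapLegs₀₁ ℓ (suc (suc i)) = ℓ (suc (suc i))

  chainAdmissibleᵇ-swap₀₁ : ∀ m x0 x1 xs ps → chainAdmissibleᵇ m (x0 ∷ x1 ∷ xs) ps ≡ chainAdmissibleᵇ m (x1 ∷ x0 ∷ xs) ps
  chainAdmissibleᵇ-swap₀₁ zero x0 x1 (x2 ∷ []) [] = admissibleᵇ-swap x0 x1 x2
  chainAdmissibleᵇ-swap₀₁ (suc m) x0 x1 xs (p0 ∷ ps) = cong (_∧ chainAdmissibleᵇ m (p0 ∷ xs) ps) (admissibleᵇ-swap x0 x1 p0)

  chainSum-swap₀₁ : ∀ m ℓ → chainSum m ℓ ≡ chainSum m (swapLegs₀₁ ℓ)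
  chainSum-swap₀₁ m ℓ = trans (∑-comm N N (λ x0 x1 → ∑ᵥ (suc m) (λ xs → ∑ᵥ m (λ ps → ∏-legs ℓ (x0 ∷ x1 ∷ xs) * χ (chainAdmissibleᵇ m (x0 ∷ x1 ∷ xs) ps))))) (∑-cong N (λ x1 _ → ∑-cong N (λ x0 _ → ∑ᵥ-cong (suc m) (λ xs _ → ∑ᵥ-cong m (λ ps _ →
      cong₂ _*_ (r (ℓ 0 x0) (ℓ 1 x1) (∏-legs (λ i → ℓ (suc (suc i))) xs)) (cong χ (chainAdmissibleᵇ-swap₀₁ m x0 x1 xs ps)))))))
    where
    r : ∀ a b c → a * (b * c) ≡ b * (a * c)
    r = ZS.solve-∀

  swapLegs₁₂ : (ℕ → ℕ → ℤ) → ℕ → ℕ → ℤ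
  swapLegs₁₂ ℓ (suc zero) = ℓ 2
  swapLegs₁₂ ℓ (suc (suc zero)) = ℓ 1
  swapLegs₁₂ ℓ i = ℓ i

  chainSum₀-swap₁₂ : ∀ ℓ → chainSum 0 ℓ ≡ chainSum 0 (swapLegs₁₂ ℓ)
  chainSum₀-swap₁₂ ℓ = ∑-cong N (λ x0 _ → trans (∑-comm N N (λ x1 x2 → (ℓ 0 x0 * (ℓ 1 x1 * (ℓ 2 x2 * 1ℤ))) * χ (admissibleᵇ x0 x1 x2))) (∑-cong N (λ x2 _ → ∑-cong N (λ x1 _ →
      cong₂ _*_ (r (ℓ 0 x0) (ℓ 1 x1) (ℓ 2 x2)) (cong χ (admissibleᵇ-swap₂₃ x0 x1 x2))))))
    where
    r : ∀ a b c → a * (b * (c * 1ℤ)) ≡ a * (c * (b * 1ℤ))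
    r = ZS.solve-∀

  chainSum₀-sign-leg₂ : ∀ ℓ → (∀ z → ℓ 2 z ≡ sign z) → chainSum 0 ℓ ≡ signed (ℓ 0) * (signed (ℓ 1) * 1ℤ)
  chainSum₀-sign-leg₂ ℓ h = begin
    ∑ N (λ x0 → ∑ N (λ x1 → ∑ N (λ x2 → (ℓ 0 x0 * (ℓ 1 x1 * (ℓ 2 x2 * 1ℤ))) * χ (admissibleᵇ x0 x1 x2))))
      ≡⟨ ∑-cong N (λ x0 _ → ∑-cong N (λ x1 _ → ∑-cong N (λ x2 _ → summand x0 x1 x2))) ⟩
    ∑ N (λ x0 → ∑ N (λ x1 → ∑ N (λ x2 → sign x2 * (ℓ 0 x0 * (ℓ 1 x1 * χ (admissibleᵇ x0 x1 x2))))))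
      ≡⟨ signed-pair (ℓ 0) (ℓ 1) ⟩
    signed (ℓ 0) * signed (ℓ 1)
      ≡⟨ cong (signed (ℓ 0) *_) (sym (ℤP.*-identityʳ _)) ⟩
    signed (ℓ 0) * (signed (ℓ 1) * 1ℤ) ∎
    where
    open ≡-Reasoning
    regroup : ∀ a b s c → (a * (b * (s * 1ℤ))) * c ≡ s * (a * (b * c))
    regroup = ZS.solve-∀
    summand : ∀ x0 x1 x2 → (ℓ 0 x0 * (ℓ 1 x1 * (ℓ 2 x2 * 1ℤ))) * χ (admissibleᵇ x0 x1 x2) ≡ sign x2 * (ℓ 0 x0 * (ℓ 1 x1 * χ (admissibleᵇ x0 x1 x2)))
    summand x0 x1 x2 rewrite h x2 = regroup (ℓ 0 x0) (ℓ 1 x1) (sign x2) _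

  chainSum-sign-leg : ∀ m ℓ (a : Fin (3 +ℕ m)) → (∀ z → ℓ (toℕ a) z ≡ sign z) → chainSum m ℓ ≡ ∏-signed-except (3 +ℕ m) ℓ a
  chainSum-sign-leg zero ℓ (suc (suc zero)) h = chainSum₀-sign-leg₂ ℓ h
  chainSum-sign-leg zero ℓ (suc zero) h = trans (chainSum₀-swap₁₂ ℓ) (chainSum₀-sign-leg₂ (swapLegs₁₂ ℓ) h)
  chainSum-sign-leg zero ℓ zero h = trans (chainSum-swap₀₁ 0 ℓ) (trans (chainSum₀-swap₁₂ (swapLegs₀₁ ℓ)) (chainSum₀-sign-leg₂ (swapLegs₁₂ (swapLegs₀₁ ℓ)) h))
  chainSum-sign-leg (suc m) ℓ zero h = trans (chainSum-contract m ℓ h) (cong (signed (ℓ 1) *_) (chainSum-sign-leg m (contractFirstLegs ℓ) zero (λ z → refl)))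
  chainSum-sign-leg (suc m) ℓ (suc zero) h = trans (chainSum-swap₀₁ (suc m) ℓ) (trans (chainSum-contract m (swapLegs₀₁ ℓ) h) (cong (signed (ℓ 0) *_) (chainSum-sign-leg m (contractFirstLegs (swapLegs₀₁ ℓ)) zero (λ z → refl))))
  chainSum-sign-leg (suc m) ℓ (suc (suc a)) h = trans (chainSum-merge m ℓ) (trans (chainSum-sign-leg m (mergeFirstLegs ℓ) (suc a) h) (trans (cong (_* ∏-signed-except (2 +ℕ m) (λ i → ℓ (suc (suc i))) a) (signed-mergeFirstLegs ℓ)) (ℤP.*-assoc (signed (ℓ 0)) (signed (ℓ 1)) _)))

  -- Node j of the caterpillar for ℕ-indexed labellings lx of the legs and lp of the path: its
  -- third edge is p_j, except for the last node j = m, where it is the leg x_{m+2}.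
  thirdEdge : ℕ → (ℕ → ℕ) → (ℕ → ℕ) → ℕ → ℕ
  thirdEdge m lx lp j = if j ℕ.≡ᵇ m then lx (suc (suc m)) else lp j

  nodeAdmissibleᵇ : ℕ → (ℕ → ℕ) → (ℕ → ℕ) → ℕ → Bool
  nodeAdmissibleᵇ m lx lp zero = admissibleᵇ (lx 0) (lx 1) (thirdEdge m lx lp 0)
  nodeAdmissibleᵇ m lx lp (suc j) = admissibleᵇ (lp j) (lx (suc (suc j))) (thirdEdge m lx lp (suc j))

  all<-nodeAdmissibleᵇ : ∀ m (x : Vec ℕ (3 +ℕ m)) (p : Vec ℕ m) → all< (suc m) (nodeAdmissibleᵇ m (lookupℕ x) (lookupℕ p)) ≡ chainAdmissibleᵇ m x p
  all<-nodeAdmissibleᵇ zero (x0 ∷ x1 ∷ x2 ∷ []) [] = BP.∧-identityʳ _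
  all<-nodeAdmissibleᵇ (suc m) (x0 ∷ x1 ∷ xs) (p0 ∷ ps) = cong (admissibleᵇ x0 x1 p0 ∧_) (trans (all<-cong (suc m) pt) (all<-nodeAdmissibleᵇ m (p0 ∷ xs) ps))
    where
    pt : ∀ j → j <ℕ suc m → nodeAdmissibleᵇ (suc m) (lookupℕ (x0 ∷ x1 ∷ xs)) (lookupℕ (p0 ∷ ps)) (suc j) ≡ nodeAdmissibleᵇ m (lookupℕ (p0 ∷ xs)) (lookupℕ ps) j
    pt zero _ = refl
    pt (suc j) _ = refl

  thirdEdge-cong : ∀ m {f f' g g' : ℕ → ℕ} → (∀ i → i <ℕ 3 +ℕ m → f i ≡ f' i) → (∀ j → j <ℕ m → g j ≡ g' j) → ∀ j → j ≤ℕ m → thirdEdge m f g j ≡ thirdEdge m f' g' j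
  thirdEdge-cong m {f} {f'} {g} {g'} hf hg j le with j ≡ᵇ m in e
  ... | true = hf (suc (suc m)) (ℕP.n<1+n (suc (suc m)))
  ... | false = hg j (ℕP.≤∧≢⇒< le (λ je → BP.not-¬ (trans (sym (≡⇒≡ᵇ-true je)) e) refl))

  nodeAdmissibleᵇ-cong : ∀ m {f f' g g' : ℕ → ℕ} → (∀ i → i <ℕ 3 +ℕ m → f i ≡ f' i) → (∀ j → j <ℕ m → g j ≡ g' j) → ∀ j → j ≤ℕ m → nodeAdmissibleᵇ m f g j ≡ nodeAdmissibleᵇ m f' g' j
  nodeAdmissibleᵇ-cong m {f} {f'} {g} {g'} hf hg zero le = trans (cong₂ (λ a b → admissibleᵇ a b (thirdEdge m f g 0)) (hf 0 (s≤s z≤n)) (hf 1 (s≤s (s≤s z≤n)))) (cong (admissibleᵇ (f' 0) (f' 1)) (thirdEdge-cong m hf hg 0 le))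
  nodeAdmissibleᵇ-cong m {f} {f'} {g} {g'} hf hg (suc j) le = trans (cong₂ (λ a b → admissibleᵇ a b (thirdEdge m f g (suc j))) (hg j le) (hf (suc (suc j)) (s≤s (s≤s (ℕP.≤-trans le (ℕP.n≤1+n m)))))) (cong (admissibleᵇ (g' j) (f' (suc (suc j)))) (thirdEdge-cong m hf hg (suc j) le))

-- Counting lattice points by parity

toℤ : ∀ {m} → Vec ℕ m → Vec ℤ m
toℤ = Vec.map (λ n → + n)

toℤ-injective : ∀ {m} {u v : Vec ℕ m} → toℤ u ≡ toℤ v → u ≡ v
toℤ-injective {u = []} {[]} e = refl
toℤ-injective {u = x ∷ u} {y ∷ v} e with VecP.∷-injective e
... | e₁ , e₂ = cong₂ _∷_ (ℤP.+-injective e₁) (toℤ-injective e₂)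

lookup≡lookupℕ : ∀ {M} (u : Vec ℕ M) (a : Fin M) → Vec.lookup u a ≡ lookupℕ u (toℕ a)
lookup≡lookupℕ (x ∷ u) zero = refl
lookup≡lookupℕ (x ∷ u) (suc a) = lookup≡lookupℕ u a

toℤ-at : ∀ {M} (u : Vec ℕ M) (a : Fin M) → toℤ u at a ≡ + lookupℕ u (toℕ a)
toℤ-at u a = trans (VecP.lookup-map a (λ n → + n) u) (cong +_ (lookup≡lookupℕ u a))

∑ₗ : ∀ {A : Set} → (A → ℤ) → List A → ℤ
∑ₗ f [] = 0ℤ
∑ₗ f (x ∷ xs) = f x + ∑ₗ f xs

∑ₗ-++ : ∀ {A : Set} (f : A → ℤ) xs ys → ∑ₗ f (xs ++ ys) ≡ ∑ₗ f xs + ∑ₗ f ys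
∑ₗ-++ f [] ys = sym (ℤP.+-identityˡ _)
∑ₗ-++ f (x ∷ xs) ys = trans (cong (_+_ (f x)) (∑ₗ-++ f xs ys)) (sym (ℤP.+-assoc (f x) _ _))

∑ₗ-map : ∀ {A B : Set} (f : B → ℤ) (g : A → B) xs → ∑ₗ f (map g xs) ≡ ∑ₗ (λ x → f (g x)) xs
∑ₗ-map f g [] = refl
∑ₗ-map f g (x ∷ xs) = cong (_+_ (f (g x))) (∑ₗ-map f g xs)

∑ₗ-cartesianProduct : ∀ {A B C : Set} (f : C → ℤ) (g : A → B → C) xs ys → ∑ₗ f (cartesianProductWith g xs ys) ≡ ∑ₗ (λ x → ∑ₗ (λ y → f (g x y)) ys) xs
∑ₗ-cartesianProduct f g [] ys = refl
∑ₗ-cartesianProduct f g (x ∷ xs) ys = trans (∑ₗ-++ f (map (g x) ys) _) (cong₂ _+_ (∑ₗ-map f (g x) ys) (∑ₗ-cartesianProduct f g xs ys))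

∑ₗ-applyUpTo : ∀ (f : ℕ → ℤ) (g : ℕ → ℕ) n → ∑ₗ f (applyUpTo g n) ≡ ∑ n (λ i → f (g i))
∑ₗ-applyUpTo f g zero = refl
∑ₗ-applyUpTo f g (suc n) = cong (_+_ (f (g 0))) (∑ₗ-applyUpTo f (λ i → g (suc i)) n)

signᵇ : Bool → ℤ
signᵇ true = 1ℤ
signᵇ false = - 1ℤ

signᵇ-isEven : ∀ n → signᵇ (isEven n) ≡ sign n
signᵇ-isEven zero = refl
signᵇ-isEven (suc zero) = refl
signᵇ-isEven (suc (suc n)) = signᵇ-isEven n

count-even-minus-odd : ∀ {A : Set} (b e : A → Bool) L →
      + length (filter (λ u → T? (b u ∧ e u)) L) - + length (filter (λ u → T? (b u ∧ not (e u))) L)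
        ≡ ∑ₗ (λ u → signᵇ (e u) * χ (b u)) L
count-even-minus-odd b e [] = refl
count-even-minus-odd b e (u ∷ L) with b u | e u
... | true | true = trans (step (+ length (filter (λ u → T? (b u ∧ e u)) L)) (+ length (filter (λ u → T? (b u ∧ not (e u))) L))) (cong (_+_ (1ℤ * 1ℤ)) (count-even-minus-odd b e L))
  where
  step : ∀ a c → (1ℤ + a) - c ≡ 1ℤ * 1ℤ + (a - c)
  step = ZS.solve-∀
... | true | false = trans (step (+ length (filter (λ u → T? (b u ∧ e u)) L)) (+ length (filter (λ u → T? (b u ∧ not (e u))) L))) (cong (_+_ (- 1ℤ * 1ℤ)) (count-even-minus-odd b e L))
  where
  step : ∀ a c → a - (1ℤ + c) ≡ - 1ℤ * 1ℤ + (a - c)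
  step = ZS.solve-∀
... | false | true = trans (sym (ℤP.+-identityˡ _)) (cong (_+_ (1ℤ * 0ℤ)) (count-even-minus-odd b e L))
... | false | false = trans (sym (ℤP.+-identityˡ _)) (cong (_+_ (- 1ℤ * 0ℤ)) (count-even-minus-odd b e L))

isEven⇒2∣ : ∀ n → T (isEven n) → 2 ∣ℕ n
isEven⇒2∣ zero _ = divides 0 refl
isEven⇒2∣ (suc (suc n)) p with isEven⇒2∣ n p
... | divides q e = divides (suc q) (cong (λ z → suc (suc z)) e)

2∣⇒isEven : ∀ n → 2 ∣ℕ n → T (isEven n)
2∣⇒isEven zero _ = tt
2∣⇒isEven (suc zero) (divides zero ())
2∣⇒isEven (suc zero) (divides (suc q) e) with ℕP.+-cancelˡ-≡ 1 _ _ e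
... | ()
2∣⇒isEven (suc (suc n)) d = 2∣⇒isEven n (ND.∣m+n∣m⇒∣n d (ND.∣-refl {2}))

¬T⇒T-not : ∀ {b} → ¬ T b → T (not b)
¬T⇒T-not {true} p = p tt
¬T⇒T-not {false} p = tt

T-not⇒¬T : ∀ {b} → T (not b) → ¬ T b
T-not⇒¬T {true} () _

module Enumeration (N : ℕ) where
  open VectorSum N

  boxList : (m : ℕ) → List (Vec ℕ m)
  boxList zero = [] ∷ []
  boxList (suc m) = cartesianProductWith _∷_ (upTo N) (boxList m)

  boxList-unique : ∀ m → Unique (boxList m)
  boxList-unique zero = LA.[] ∷ []
  boxList-unique (suc m) = cartesianProductWith⁺ _∷_ VecP.∷-injective (upTo⁺ N) (boxList-unique m)

  ∈-boxList⁺ : ∀ {m} (u : Vec ℕ m) → Bounded u → u ∈ boxList m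
  ∈-boxList⁺ [] [] = Any.here refl
  ∈-boxList⁺ (x ∷ u) (x< ∷ b) = ∈-cartesianProductWith⁺ _∷_ (∈-upTo⁺ x<) (∈-boxList⁺ u b)

  ∈-boxList⁻ : ∀ {m} (u : Vec ℕ m) → u ∈ boxList m → Bounded u
  ∈-boxList⁻ [] _ = []
  ∈-boxList⁻ {suc m} (x ∷ u) p with ∈-cartesianProductWith⁻ _∷_ (upTo N) (boxList m) p
  ... | y , v , y∈ , v∈ , e with VecP.∷-injective e
  ... | refl , refl = ∈-upTo⁻ y∈ ∷ ∈-boxList⁻ v v∈

  ∑ₗ-boxList : ∀ m (F : Vec ℕ m → ℤ) → ∑ₗ F (boxList m) ≡ ∑ᵥ m F
  ∑ₗ-boxList zero F = ℤP.+-identityʳ _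
  ∑ₗ-boxList (suc m) F = trans (∑ₗ-cartesianProduct F _∷_ (upTo N) (boxList m)) (trans (∑ₗ-applyUpTo (λ x → ∑ₗ (λ y → F (x ∷ y)) (boxList m)) (λ i → i) N) (∑-cong N (λ x _ → ∑ₗ-boxList m (λ v → F (x ∷ v)))))

  lookup-toℤ : ∀ {m} (u : Vec ℕ m) a → toℤ u at a ≡ + Vec.lookup u a
  lookup-toℤ u a = VecP.lookup-map a (λ n → + n) u

  vol-ev-minus-od : (G : Graph) (t : ℕ) (a : Fin (nE G)) (good : Vec ℕ (nE G) → Bool)
    (inDilate⇒bounded : ∀ w → InDilate G t w → ∃ λ u → Bounded u × w ≡ toℤ u)
    (inDilate⇒goodᵇ : ∀ u → Bounded u → InDilate G t (toℤ u) → T (good u))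
    (goodᵇ⇒inDilate : ∀ u → Bounded u → T (good u) → InDilate G t (toℤ u)) →
    Σ ℕ λ ne → Σ ℕ λ no → VolEv G a t ne × VolOd G a t no ×
      (+ ne - + no ≡ ∑ᵥ (nE G) (λ u → sign (Vec.lookup u a) * χ (good u)))
  vol-ev-minus-od G t a good inDilate⇒bounded inDilate⇒goodᵇ goodᵇ⇒inDilate =
      length evens , length odds ,
      (map toℤ evens , map⁺ toℤ-injective (filter⁺ _ (boxList-unique M)) , ∈-evens , LP.length-map toℤ evens) ,
      (map toℤ odds , map⁺ toℤ-injective (filter⁺ _ (boxList-unique M)) , ∈-odds , LP.length-map toℤ odds) ,
      trans (count-even-minus-odd good ev (boxList M)) (trans (∑ₗ-boxList M _) (∑ᵥ-cong M (λ u _ → cong (_* χ (good u)) (signᵇ-isEven (Vec.lookup u a)))))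
    where
    M = nE G
    ev : Vec ℕ M → Bool
    ev u = isEven (Vec.lookup u a)
    evens odds : List (Vec ℕ M)
    evens = filter (λ u → T? (good u ∧ ev u)) (boxList M)
    odds = filter (λ u → T? (good u ∧ not (ev u))) (boxList M)
    ev⇒Even : ∀ u → T (ev u) → Even (toℤ u at a)
    ev⇒Even u p rewrite lookup-toℤ u a = isEven⇒2∣ _ p
    Even⇒ev : ∀ u → Even (toℤ u at a) → T (ev u)
    Even⇒ev u p rewrite lookup-toℤ u a = 2∣⇒isEven _ p
    ∈-evens : ∀ x → (x ∈ map toℤ evens) ⇔ (InDilate G t x × Even (x at a))
    ∈-evens x = mk⇔ to from
      where
      to : x ∈ map toℤ evens → InDilate G t x × Even (x at a)
      to p with ∈-map⁻ toℤ p
      ... | u , u∈ , refl with ∈-filter⁻ (λ u → T? (good u ∧ ev u)) {xs = boxList M} u∈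
      ... | u∈b , gu = goodᵇ⇒inDilate u (∈-boxList⁻ u u∈b) (T-∧-l gu) , ev⇒Even u (T-∧-r {good u} gu)
      from : InDilate G t x × Even (x at a) → x ∈ map toℤ evens
      from (ind , evx) with inDilate⇒bounded x ind
      ... | u , bu , refl = ∈-map⁺ toℤ (∈-filter⁺ (λ u → T? (good u ∧ ev u)) (∈-boxList⁺ u bu) (T-∧-intro (inDilate⇒goodᵇ u bu ind) (Even⇒ev u evx)))
    ∈-odds : ∀ x → (x ∈ map toℤ odds) ⇔ (InDilate G t x × Odd (x at a))
    ∈-odds x = mk⇔ to from
      where
      to : x ∈ map toℤ odds → InDilate G t x × Odd (x at a)
      to p with ∈-map⁻ toℤ p
      ... | u , u∈ , refl with ∈-filter⁻ (λ u → T? (good u ∧ not (ev u))) {xs = boxList M} u∈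
      ... | u∈b , gu = goodᵇ⇒inDilate u (∈-boxList⁻ u u∈b) (T-∧-l gu) , (λ e → T-not⇒¬T (T-∧-r {good u} gu) (Even⇒ev u e))
      from : InDilate G t x × Odd (x at a) → x ∈ map toℤ odds
      from (ind , odx) with inDilate⇒bounded x ind
      ... | u , bu , refl = ∈-map⁺ toℤ (∈-filter⁺ (λ u → T? (good u ∧ not (ev u))) (∈-boxList⁺ u bu) (T-∧-intro (inDilate⇒goodᵇ u bu ind) (¬T⇒T-not (λ e → odx (ev⇒Even u e)))))

-- Out of range, edgeAt returns the junk edge (0 , 0).
edgeAt : Graph → ℕ → ℕ × ℕ
edgeAt [] i = (0 , 0)
edgeAt (e ∷ G) zero = e
edgeAt (e ∷ G) (suc i) = edgeAt G i

lookup≡edgeAt : ∀ G (i : Fin (nE G)) → edge G i ≡ edgeAt G (toℕ i)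
lookup≡edgeAt (e ∷ G) zero = refl
lookup≡edgeAt (e ∷ G) (suc i) = lookup≡edgeAt G i

edgeAt-++ˡ : ∀ A B i → i <ℕ length A → edgeAt (A ++ B) i ≡ edgeAt A i
edgeAt-++ˡ (e ∷ A) B zero _ = refl
edgeAt-++ˡ (e ∷ A) B (suc i) (s≤s lt) = edgeAt-++ˡ A B i lt

edgeAt-++ʳ : ∀ A B j → edgeAt (A ++ B) (length A +ℕ j) ≡ edgeAt B j
edgeAt-++ʳ [] B j = refl
edgeAt-++ʳ (e ∷ A) B j = edgeAt-++ʳ A B j

edgeAt-map : ∀ (f : ℕ → ℕ × ℕ) (g : ℕ → ℕ) n i → i <ℕ n → edgeAt (map f (applyUpTo g n)) i ≡ f (g i)
edgeAt-map f g (suc n) zero _ = refl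
edgeAt-map f g (suc n) (suc i) (s≤s lt) = edgeAt-map f (λ j → g (suc j)) n i lt

endsAt : ℕ × ℕ → ℕ → ℕ → List ℕ
endsAt (x , y) v i = (if x ≡ᵇ v then i ∷ [] else []) ++ (if y ≡ᵇ v then i ∷ [] else [])

endsAt-none : ∀ x y v i → x ≢ v → y ≢ v → endsAt (x , y) v i ≡ []
endsAt-none x y v i a b rewrite ≢⇒≡ᵇ-false a | ≢⇒≡ᵇ-false b = refl
endsAt-first : ∀ x y v i → x ≡ v → y ≢ v → endsAt (x , y) v i ≡ i ∷ []
endsAt-first x y v i a b rewrite ≡⇒≡ᵇ-true a | ≢⇒≡ᵇ-false b = refl
endsAt-second : ∀ x y v i → x ≢ v → y ≡ v → endsAt (x , y) v i ≡ i ∷ []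
endsAt-second x y v i a b rewrite ≢⇒≡ᵇ-false a | ≡⇒≡ᵇ-true b = refl
endsAt-both : ∀ x y v i → x ≡ v → y ≡ v → endsAt (x , y) v i ≡ i ∷ i ∷ []
endsAt-both x y v i a b rewrite ≡⇒≡ᵇ-true a | ≡⇒≡ᵇ-true b = refl

concatUpTo : (ℕ → List ℕ) → ℕ → List ℕ
concatUpTo φ zero = []
concatUpTo φ (suc n) = φ 0 ++ concatUpTo (λ i → φ (suc i)) n

concatUpTo-cong : ∀ n {φ ψ : ℕ → List ℕ} → (∀ i → i <ℕ n → φ i ≡ ψ i) → concatUpTo φ n ≡ concatUpTo ψ n
concatUpTo-cong zero h = refl
concatUpTo-cong (suc n) h = cong₂ _++_ (h 0 (s≤s z≤n)) (concatUpTo-cong n (λ i i<n → h (suc i) (s≤s i<n)))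

concatUpTo-split : ∀ a b (φ : ℕ → List ℕ) → concatUpTo φ (a +ℕ b) ≡ concatUpTo φ a ++ concatUpTo (λ i → φ (a +ℕ i)) b
concatUpTo-split zero b φ = refl
concatUpTo-split (suc a) b φ = trans (cong (φ 0 ++_) (concatUpTo-split a b (λ i → φ (suc i)))) (sym (LP.++-assoc (φ 0) _ _))

concatUpTo-[] : ∀ n {φ : ℕ → List ℕ} → (∀ i → i <ℕ n → φ i ≡ []) → concatUpTo φ n ≡ []
concatUpTo-[] zero h = refl
concatUpTo-[] (suc n) h = cong₂ _++_ (h 0 (s≤s z≤n)) (concatUpTo-[] n (λ i i<n → h (suc i) (s≤s i<n)))

concatUpTo-single : ∀ n p (φ : ℕ → List ℕ) → p <ℕ n → (∀ i → i <ℕ n → i ≢ p → φ i ≡ []) → concatUpTo φ n ≡ φ p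
concatUpTo-single n p φ p<n h with ℕP.m≤n⇒∃[o]m+o≡n p<n
... | r , refl = trans (cong (λ z → concatUpTo φ z) (sym (ℕP.+-suc p r))) (trans (concatUpTo-split p (suc r) φ)
    (trans (cong₂ _++_ (concatUpTo-[] p (λ i i<p → h i (ℕP.<-trans i<p (s≤s (ℕP.m≤m+n p r))) (λ e → ℕP.<-irrefl e i<p)))
                       (cong (φ (p +ℕ 0) ++_) (concatUpTo-[] r (λ i i<r → h (p +ℕ suc i) (subst (_<ℕ suc p +ℕ r) (sym (ℕP.+-suc p i)) (s≤s (ℕP.+-monoʳ-< p i<r))) (λ e → ℕP.<-irrefl (sym e) (subst (p <ℕ_) (sym (ℕP.+-suc p i)) (s≤s (ℕP.m≤m+n p i))))))))
      (trans (LP.++-identityʳ _) (cong φ (ℕP.+-identityʳ p)))))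

concatUpTo-pair : ∀ n p q (φ : ℕ → List ℕ) → p <ℕ q → q <ℕ n → (∀ i → i <ℕ n → i ≢ p → i ≢ q → φ i ≡ []) → concatUpTo φ n ≡ φ p ++ φ q
concatUpTo-pair n p q φ p<q q<n h with ℕP.m≤n⇒∃[o]m+o≡n (ℕP.<-trans p<q q<n)
... | s , refl with ℕP.m≤n⇒∃[o]m+o≡n p<q
... | r , refl = trans (concatUpTo-split (suc p) s φ) (cong₂ _++_
     (concatUpTo-single (suc p) p φ ℕP.≤-refl (λ i i<sp i≢p → h i (ℕP.<-≤-trans i<sp (ℕP.m≤m+n (suc p) s)) i≢p
        (λ e → ℕP.<-irrefl e (ℕP.≤-<-trans (ℕP.<⇒≤pred i<sp) p<q))))
     (concatUpTo-single s r (λ i → φ (suc p +ℕ i)) (ℕP.+-cancelˡ-< (suc p) r s q<n) (λ i i<s i≢r → h (suc p +ℕ i) (ℕP.+-monoʳ-< (suc p) i<s)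
        (λ e → ℕP.<-irrefl (sym e) (s≤s (ℕP.m≤m+n p i))) (λ e → i≢r (ℕP.+-cancelˡ-≡ (suc p) i r e)))))

∈-concatUpTo : ∀ n (φ : ℕ → List ℕ) i x → i <ℕ n → x ∈ φ i → x ∈ concatUpTo φ n
∈-concatUpTo (suc n) φ zero x _ p = ∈-++⁺ˡ p
∈-concatUpTo (suc n) φ (suc i) x (s≤s lt) p = ∈-++⁺ʳ (φ 0) (∈-concatUpTo n (λ j → φ (suc j)) i x lt p)

-- incident with the edges numbered by ℕ rather than by Fin (map-toℕ-incident below), so that
-- an edge list can be cut into ranges.
incidentℕ : Graph → ℕ → List ℕ
incidentℕ G v = concatUpTo (λ i → endsAt (edgeAt G i) v i) (length G)

private
  map-if : ∀ {n} (b : Bool) (i : Fin n) → map toℕ (if b then i ∷ [] else []) ≡ (if b then toℕ i ∷ [] else [])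
  map-if true i = refl
  map-if false i = refl

  concatMap-tabulate : ∀ n (φ : ℕ → List ℕ) → concatMap (λ i → φ (toℕ i)) (tabulate {n = n} (λ i → i)) ≡ concatUpTo φ n
  concatMap-tabulate zero φ = refl
  concatMap-tabulate (suc n) φ = cong (φ 0 ++_) (trans (cong concat (trans (LP.map-tabulate {n = n} suc (λ i → φ (toℕ i))) (sym (LP.map-tabulate {n = n} (λ i → i) (λ i → φ (suc (toℕ i))))))) (concatMap-tabulate n (λ i → φ (suc i))))

map-toℕ-incident : ∀ G v → map toℕ (incident G v) ≡ incidentℕ G v
map-toℕ-incident G v = trans (LP.map-concatMap toℕ _ (allFin (nE G))) (trans (LP.concatMap-cong pt (allFin (nE G))) (concatMap-tabulate (nE G) (λ i → endsAt (edgeAt G i) v i)))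
  where
  pt : ∀ (i : Fin (nE G)) → map toℕ ((if proj₁ (edge G i) ≡ᵇ v then i ∷ [] else []) ++ (if proj₂ (edge G i) ≡ᵇ v then i ∷ [] else [])) ≡ endsAt (edgeAt G (toℕ i)) v (toℕ i)
  pt i rewrite LP.map-++ toℕ (if proj₁ (edge G i) ≡ᵇ v then i ∷ [] else []) (if proj₂ (edge G i) ≡ᵇ v then i ∷ [] else []) | map-if (proj₁ (edge G i) ≡ᵇ v) i | map-if (proj₂ (edge G i) ≡ᵇ v) i | lookup≡edgeAt G i = refl

degree≡length-incidentℕ : ∀ G v → degree G v ≡ length (incidentℕ G v)
degree≡length-incidentℕ G v = trans (sym (LP.length-map toℕ (incident G v))) (cong length (map-toℕ-incident G v))

map-toℕ-triple : ∀ {n} (L : List (Fin n)) i0 i1 i2 → map toℕ L ≡ i0 ∷ i1 ∷ i2 ∷ [] →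
       ∃ λ a → ∃ λ b → ∃ λ c → L ≡ a ∷ b ∷ c ∷ [] × toℕ a ≡ i0 × toℕ b ≡ i1 × toℕ c ≡ i2
map-toℕ-triple (a ∷ b ∷ c ∷ []) i0 i1 i2 refl = a , b , c , refl , refl , refl , refl

incident-triple : ∀ G v (a b c : Fin (nE G)) {i0 i1 i2} → incidentℕ G v ≡ i0 ∷ i1 ∷ i2 ∷ [] → incident G v ≡ a ∷ b ∷ c ∷ [] → toℕ a ≡ i0 × toℕ b ≡ i1 × toℕ c ≡ i2
incident-triple G v a b c e1 e2 with trans (sym (cong (map toℕ) e2)) (trans (map-toℕ-incident G v) e1)
... | refl = refl , refl , refl

incident-triple′ : ∀ G v {i0 i1 i2} → incidentℕ G v ≡ i0 ∷ i1 ∷ i2 ∷ [] → ∃ λ a → ∃ λ b → ∃ λ c → incident G v ≡ a ∷ b ∷ c ∷ [] × toℕ a ≡ i0 × toℕ b ≡ i1 × toℕ c ≡ i2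
incident-triple′ G v e = map-toℕ-triple (incident G v) _ _ _ (trans (map-toℕ-incident G v) e)

∈-incidentℕ₁ : ∀ G i → i <ℕ length G → i ∈ incidentℕ G (proj₁ (edgeAt G i))
∈-incidentℕ₁ G i lt = ∈-concatUpTo (length G) _ i i lt (∈-endsAt₁ (edgeAt G i))
  where
  ∈-endsAt₁ : ∀ e → i ∈ endsAt e (proj₁ e) i
  ∈-endsAt₁ (x , y) rewrite ≡ᵇ-refl x = Any.here refl

∈-incidentℕ₂ : ∀ G i → i <ℕ length G → i ∈ incidentℕ G (proj₂ (edgeAt G i))
∈-incidentℕ₂ G i lt = ∈-concatUpTo (length G) _ i i lt (∈-endsAt₂ (edgeAt G i))
  where
  ∈-endsAt₂ : ∀ e → i ∈ endsAt e (proj₂ e) i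
  ∈-endsAt₂ (x , y) rewrite ≡ᵇ-refl y = ∈-++⁺ʳ (if x ≡ᵇ y then i ∷ [] else []) (Any.here refl)

-- The graph G_{h,k}

loopsAt : ℕ → ℕ → Graph
loopsAt h k = map (λ i → (h +ℕ i , h +ℕ i)) (upTo k)

-- For h + k = n = m + 3 the edges of G_{h,k} are numbered as follows: leg i < n joins leaf i to
-- the path node n + min(i − 1, m), path edge n + j joins the path nodes n + j and n + j + 1, and
-- edge n + m + j is the loop at leaf h + j.
module HK (h k m : ℕ) (eq : h +ℕ k ≡ suc (suc (suc m))) where
  n : ℕ
  n = suc (suc (suc m))

  legEdge : ℕ → ℕ × ℕ
  legEdge i = (i , n +ℕ ((i ∸ 1) ⊓ (n ∸ 3)))
  pathEdge : ℕ → ℕ × ℕ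
  pathEdge j = (n +ℕ j , n +ℕ suc j)
  loopEdge : ℕ → ℕ × ℕ
  loopEdge i = (h +ℕ i , h +ℕ i)

  legEdges pathEdges loopEdges : Graph
  legEdges = map legEdge (upTo n)
  pathEdges = map pathEdge (upTo m)
  loopEdges = map loopEdge (upTo k)

  G : Graph
  G = caterpillar n ++ loopsAt h k

  length-edges : ∀ (f : ℕ → ℕ × ℕ) r → length (map f (upTo r)) ≡ r
  length-edges f r = trans (LP.length-map f (upTo r)) (LP.length-upTo r)

  length-caterpillar : length (legEdges ++ pathEdges) ≡ n +ℕ m
  length-caterpillar = trans (LP.length-++ legEdges) (cong₂ _+ℕ_ (length-edges legEdge n) (length-edges pathEdge m))

  length-G : length G ≡ n +ℕ m +ℕ k
  length-G = trans (LP.length-++ (legEdges ++ pathEdges)) (cong₂ _+ℕ_ length-caterpillar (length-edges loopEdge k))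

  edgeAt-leg : ∀ i → i <ℕ n → edgeAt G i ≡ legEdge i
  edgeAt-leg i lt = trans (edgeAt-++ˡ (legEdges ++ pathEdges) loopEdges i (subst (i <ℕ_) (sym length-caterpillar) (ℕP.<-≤-trans lt (ℕP.m≤m+n n m))))
       (trans (edgeAt-++ˡ legEdges pathEdges i (subst (i <ℕ_) (sym (length-edges legEdge n)) lt)) (edgeAt-map legEdge (λ x → x) n i lt))

  edgeAt-path : ∀ j → j <ℕ m → edgeAt G (n +ℕ j) ≡ pathEdge j
  edgeAt-path j lt = trans (edgeAt-++ˡ (legEdges ++ pathEdges) loopEdges (n +ℕ j) (subst (n +ℕ j <ℕ_) (sym length-caterpillar) (ℕP.+-monoʳ-< n lt)))
       (trans (cong (edgeAt (legEdges ++ pathEdges)) (cong (_+ℕ j) (sym (length-edges legEdge n)))) (trans (edgeAt-++ʳ legEdges pathEdges j) (edgeAt-map pathEdge (λ x → x) m j lt)))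

  edgeAt-loop : ∀ j → j <ℕ k → edgeAt G (n +ℕ m +ℕ j) ≡ loopEdge j
  edgeAt-loop j lt = trans (cong (edgeAt G) (cong (_+ℕ j) (sym length-caterpillar)))
      (trans (edgeAt-++ʳ (legEdges ++ pathEdges) loopEdges j) (edgeAt-map loopEdge (λ x → x) k j lt))

  legIncidence pathIncidence loopIncidence : ℕ → List ℕ
  legIncidence v = concatUpTo (λ i → endsAt (legEdge i) v i) n
  pathIncidence v = concatUpTo (λ j → endsAt (pathEdge j) v (n +ℕ j)) m
  loopIncidence v = concatUpTo (λ j → endsAt (loopEdge j) v (n +ℕ m +ℕ j)) k

  incidentℕ-split : ∀ v → incidentℕ G v ≡ (legIncidence v ++ pathIncidence v) ++ loopIncidence v
  incidentℕ-split v = trans (cong (concatUpTo φ) length-G) (trans (concatUpTo-split (n +ℕ m) k φ) (cong₂ _++_ (trans (concatUpTo-split n m φ)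
      (cong₂ _++_ (concatUpTo-cong n (λ i lt → cong (λ e → endsAt e v i) (edgeAt-leg i lt))) (concatUpTo-cong m (λ j lt → cong (λ e → endsAt e v (n +ℕ j)) (edgeAt-path j lt)))))
      (concatUpTo-cong k (λ j lt → cong (λ e → endsAt e v (n +ℕ m +ℕ j)) (edgeAt-loop j lt)))))
    where
    φ : ℕ → List ℕ
    φ i = endsAt (edgeAt G i) v i

  +≢ : ∀ c {a b} → a ≢ b → c +ℕ a ≢ c +ℕ b
  +≢ c ne e = ne (ℕP.+-cancelˡ-≡ c _ _ e)

  h<n : ∀ {j} → j <ℕ k → h +ℕ j <ℕ n
  h<n {j} lt = subst (h +ℕ j <ℕ_) eq (ℕP.+-monoʳ-< h lt)

  h≤n : h ≤ℕ n
  h≤n = subst (h ≤ℕ_) eq (ℕP.m≤m+n h k)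

  ⊓≤ : ∀ x → x ⊓ m ≤ℕ m
  ⊓≤ x = ℕP.m⊓n≤n x m

  ⊓-ne : ∀ x y → y <ℕ m → x ≢ y → x ⊓ m ≢ y
  ⊓-ne x y y<m ne with ℕP.≤-total x m
  ... | inj₁ x≤m = subst (_≢ y) (sym (ℕP.m≤n⇒m⊓n≡m x≤m)) ne
  ... | inj₂ m≤x = subst (_≢ y) (sym (ℕP.m≥n⇒m⊓n≡n m≤x)) (ℕP.>⇒≢ y<m)

  legIncidence-<n : ∀ v → v <ℕ n → legIncidence v ≡ v ∷ []
  legIncidence-<n v v<n = trans (concatUpTo-single n v _ v<n (λ i i<n i≢v → endsAt-none i (n +ℕ ((i ∸ 1) ⊓ m)) v i i≢v (ℕP.>⇒≢ (ℕP.<-≤-trans v<n (ℕP.m≤m+n n _)))))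
                        (endsAt-first v (n +ℕ ((v ∸ 1) ⊓ m)) v v refl (ℕP.>⇒≢ (ℕP.<-≤-trans v<n (ℕP.m≤m+n n _))))

  pathIncidence-<n : ∀ v → v <ℕ n → pathIncidence v ≡ []
  pathIncidence-<n v v<n = concatUpTo-[] m (λ j _ → endsAt-none (n +ℕ j) (n +ℕ suc j) v (n +ℕ j) (ℕP.>⇒≢ (ℕP.<-≤-trans v<n (ℕP.m≤m+n n j))) (ℕP.>⇒≢ (ℕP.<-≤-trans v<n (ℕP.m≤m+n n (suc j)))))

  loopIncidence-<h : ∀ v → v <ℕ h → loopIncidence v ≡ []
  loopIncidence-<h v v<h = concatUpTo-[] k (λ j _ → endsAt-none (h +ℕ j) (h +ℕ j) v (n +ℕ m +ℕ j) (ℕP.>⇒≢ (ℕP.<-≤-trans v<h (ℕP.m≤m+n h j))) (ℕP.>⇒≢ (ℕP.<-≤-trans v<h (ℕP.m≤m+n h j))))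

  loopIncidence-loop : ∀ j → j <ℕ k → loopIncidence (h +ℕ j) ≡ (n +ℕ m +ℕ j) ∷ (n +ℕ m +ℕ j) ∷ []
  loopIncidence-loop j j<k = trans (concatUpTo-single k j _ j<k (λ i _ i≢j → endsAt-none (h +ℕ i) (h +ℕ i) (h +ℕ j) (n +ℕ m +ℕ i) (+≢ h i≢j) (+≢ h i≢j))) (endsAt-both (h +ℕ j) (h +ℕ j) (h +ℕ j) (n +ℕ m +ℕ j) refl refl)

  loopIncidence-≥n : ∀ v → n ≤ℕ v → loopIncidence v ≡ []
  loopIncidence-≥n v n≤v = concatUpTo-[] k (λ j j<k → endsAt-none (h +ℕ j) (h +ℕ j) v (n +ℕ m +ℕ j) (ℕP.<⇒≢ (ℕP.<-≤-trans (h<n j<k) n≤v)) (ℕP.<⇒≢ (ℕP.<-≤-trans (h<n j<k) n≤v)))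

  incidentℕ-leaf : ∀ v → v <ℕ h → incidentℕ G v ≡ v ∷ []
  incidentℕ-leaf v v<h = trans (incidentℕ-split v) (cong₂ _++_ (cong₂ _++_ (legIncidence-<n v v<n) (pathIncidence-<n v v<n)) (loopIncidence-<h v v<h))
    where
    v<n : v <ℕ n
    v<n = ℕP.<-≤-trans v<h h≤n

  incidentℕ-loop : ∀ j → j <ℕ k → incidentℕ G (h +ℕ j) ≡ (h +ℕ j) ∷ (n +ℕ m +ℕ j) ∷ (n +ℕ m +ℕ j) ∷ []
  incidentℕ-loop j j<k = trans (incidentℕ-split (h +ℕ j)) (cong₂ _++_ (cong₂ _++_ (legIncidence-<n (h +ℕ j) (h<n j<k)) (pathIncidence-<n (h +ℕ j) (h<n j<k))) (loopIncidence-loop j j<k))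

  incidentℕ-beyond : ∀ v → n +ℕ m <ℕ v → incidentℕ G v ≡ []
  incidentℕ-beyond v lt = trans (incidentℕ-split v) (cong₂ _++_ (cong₂ _++_ legs paths) (loopIncidence-≥n v (ℕP.≤-trans (ℕP.m≤m+n n m) (ℕP.<⇒≤ lt))))
    where
    legs : legIncidence v ≡ []
    legs = concatUpTo-[] n (λ i i<n → endsAt-none i (n +ℕ ((i ∸ 1) ⊓ m)) v i (ℕP.<⇒≢ (ℕP.<-trans i<n (ℕP.≤-<-trans (ℕP.m≤m+n n m) lt))) (ℕP.<⇒≢ (ℕP.≤-<-trans (ℕP.+-monoʳ-≤ n (⊓≤ (i ∸ 1))) lt)))
    paths : pathIncidence v ≡ []
    paths = concatUpTo-[] m (λ j j<m → endsAt-none (n +ℕ j) (n +ℕ suc j) v (n +ℕ j) (ℕP.<⇒≢ (ℕP.<-trans (ℕP.+-monoʳ-< n j<m) lt)) (ℕP.<⇒≢ (ℕP.≤-<-trans (ℕP.+-monoʳ-≤ n j<m) lt)))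

  n≤ : ∀ j → n ≤ℕ n +ℕ j
  n≤ j = ℕP.m≤m+n n j

  incidentℕ-onlyNode : m ≡ 0 → incidentℕ G (n +ℕ 0) ≡ 0 ∷ 1 ∷ 2 ∷ []
  incidentℕ-onlyNode m0 = trans (incidentℕ-split (n +ℕ 0)) (trans (cong₂ _++_ (cong₂ _++_ legs (concatUpTo-[] m (λ j j<m → ⊥-elim (ℕP.<⇒≱ j<m (subst (_≤ℕ j) (sym m0) z≤n))))) (loopIncidence-≥n (n +ℕ 0) (n≤ 0))) refl)
    where
    legs : legIncidence (n +ℕ 0) ≡ 0 ∷ 1 ∷ 2 ∷ []
    legs = cong₂ _++_ (endsAt-second 0 (n +ℕ 0) (n +ℕ 0) 0 (ℕP.<⇒≢ (s≤s z≤n)) refl) (cong₂ _++_ (endsAt-second 1 (n +ℕ 0) (n +ℕ 0) 1 (ℕP.<⇒≢ (s≤s (s≤s z≤n))) refl)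
             (cong₂ _++_ (endsAt-second 2 (n +ℕ (1 ⊓ m)) (n +ℕ 0) 2 (ℕP.<⇒≢ (s≤s (s≤s (s≤s z≤n)))) (cong (n +ℕ_) (subst (λ z → 1 ⊓ z ≡ 0) (sym m0) refl)))
               (concatUpTo-[] m (λ j j<m → ⊥-elim (ℕP.<⇒≱ j<m (subst (_≤ℕ j) (sym m0) z≤n))))))

  n≢sn : ∀ x → x ≢ suc x
  n≢sn x e = ℕP.<-irrefl e (ℕP.n<1+n x)

  ∸1≢ : ∀ i y → i ≢ 0 → i ≢ suc y → i ∸ 1 ≢ y
  ∸1≢ zero y a b = ⊥-elim (a refl)
  ∸1≢ (suc i) y a b e = b (cong suc e)

  ∸1≢' : ∀ i y → i ≢ suc (suc y) → i ∸ 1 ≢ suc y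
  ∸1≢' zero y a ()
  ∸1≢' (suc i) y a e = a (cong suc e)

  endsAt-leg-none : ∀ v i → i <ℕ n → n ≤ℕ v → (i ∸ 1) ⊓ m ≢ v ∸ n → endsAt (legEdge i) v i ≡ []
  endsAt-leg-none v i i<n n≤v ne = endsAt-none i (n +ℕ ((i ∸ 1) ⊓ m)) v i (ℕP.<⇒≢ (ℕP.<-≤-trans i<n n≤v))
     (λ e → ne (trans (sym (ℕP.m+n∸m≡n n _)) (trans (cong (_∸ n) e) refl)))

  endsAt-leg-attached : ∀ v i → i <ℕ n → v ≡ n +ℕ ((i ∸ 1) ⊓ m) → endsAt (legEdge i) v i ≡ i ∷ []
  endsAt-leg-attached v i i<n e = endsAt-second i (n +ℕ ((i ∸ 1) ⊓ m)) v i (ℕP.<⇒≢ (ℕP.<-≤-trans i<n (subst (n ≤ℕ_) (sym e) (ℕP.m≤m+n n _)))) (sym e)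

  incidentℕ-firstNode : 1 ≤ℕ m → incidentℕ G (n +ℕ 0) ≡ 0 ∷ 1 ∷ (n +ℕ 0) ∷ []
  incidentℕ-firstNode 1≤m = trans (incidentℕ-split (n +ℕ 0)) (cong₂ _++_ (cong₂ _++_ legs paths) (loopIncidence-≥n (n +ℕ 0) (n≤ 0)))
    where
    legs : legIncidence (n +ℕ 0) ≡ 0 ∷ 1 ∷ []
    legs = trans (concatUpTo-pair n 0 1 _ (s≤s z≤n) (s≤s (s≤s z≤n)) (λ i i<n i≢0 i≢1 → endsAt-leg-none (n +ℕ 0) i i<n (n≤ 0)
              (subst ((i ∸ 1) ⊓ m ≢_) (sym (ℕP.m+n∸m≡n n 0)) (⊓-ne (i ∸ 1) 0 1≤m (∸1≢ i 0 i≢0 i≢1)))))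
           (cong₂ _++_ (endsAt-leg-attached (n +ℕ 0) 0 (s≤s z≤n) refl) (endsAt-leg-attached (n +ℕ 0) 1 (s≤s (s≤s z≤n)) refl))
    paths : pathIncidence (n +ℕ 0) ≡ (n +ℕ 0) ∷ []
    paths = trans (concatUpTo-single m 0 _ 1≤m (λ j j<m j≢0 → endsAt-none (n +ℕ j) (n +ℕ suc j) (n +ℕ 0) (n +ℕ j) (+≢ n j≢0) (+≢ n (λ ()))))
             (endsAt-first (n +ℕ 0) (n +ℕ 1) (n +ℕ 0) (n +ℕ 0) refl (+≢ n (λ ())))

  incidentℕ-middleNode : ∀ j → suc j <ℕ m → incidentℕ G (n +ℕ suc j) ≡ suc (suc j) ∷ (n +ℕ j) ∷ (n +ℕ suc j) ∷ []
  incidentℕ-middleNode j sj<m = trans (incidentℕ-split v) (cong₂ _++_ (cong₂ _++_ legs paths) (loopIncidence-≥n v (n≤ (suc j))))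
    where
    v = n +ℕ suc j
    legs : legIncidence v ≡ suc (suc j) ∷ []
    legs = trans (concatUpTo-single n (suc (suc j)) _ (s≤s (s≤s (s≤s (ℕP.<⇒≤ (ℕP.<-trans (ℕP.n<1+n j) sj<m)))))
              (λ i i<n i≢ → endsAt-leg-none v i i<n (n≤ (suc j)) (subst ((i ∸ 1) ⊓ m ≢_) (sym (ℕP.m+n∸m≡n n (suc j))) (⊓-ne (i ∸ 1) (suc j) sj<m (∸1≢' i j i≢)))))
           (endsAt-leg-attached v (suc (suc j)) (s≤s (s≤s (s≤s (ℕP.<⇒≤ (ℕP.<-trans (ℕP.n<1+n j) sj<m))))) (cong (n +ℕ_) (sym (ℕP.m≤n⇒m⊓n≡m (ℕP.<⇒≤ sj<m)))))
    paths : pathIncidence v ≡ (n +ℕ j) ∷ (n +ℕ suc j) ∷ []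
    paths = trans (concatUpTo-pair m j (suc j) _ (ℕP.n<1+n j) sj<m (λ i i<m i≢j i≢sj → endsAt-none (n +ℕ i) (n +ℕ suc i) v (n +ℕ i) (+≢ n i≢sj) (+≢ n (λ e → i≢j (ℕP.suc-injective e)))))
       (cong₂ _++_ (endsAt-second (n +ℕ j) (n +ℕ suc j) v (n +ℕ j) (+≢ n (n≢sn j)) refl) (endsAt-first (n +ℕ suc j) (n +ℕ suc (suc j)) v (n +ℕ suc j) refl (+≢ n (λ e → n≢sn (suc j) (sym e)))))

  incidentℕ-lastNode : ∀ m' → m ≡ suc m' → incidentℕ G (n +ℕ m) ≡ suc m ∷ suc (suc m) ∷ (n +ℕ m') ∷ []
  incidentℕ-lastNode m' em = trans (incidentℕ-split v) (cong₂ _++_ (cong₂ _++_ legs paths) (loopIncidence-≥n v (n≤ m)))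
    where
    v = n +ℕ m
    low : ∀ i → i <ℕ n → i ≢ suc m → i ≢ suc (suc m) → i ≤ℕ m
    low i i<n a b = ℕ.s≤s⁻¹ (ℕP.≤∧≢⇒< (ℕ.s≤s⁻¹ (ℕP.≤∧≢⇒< (ℕ.s≤s⁻¹ i<n) b)) a)
    pl : ∀ i → i ≤ℕ m → i ∸ 1 <ℕ m
    pl zero _ = subst (0 <ℕ_) (sym em) (s≤s z≤n)
    pl (suc i) le = ℕP.<-≤-trans (ℕP.n<1+n i) le
    legs : legIncidence v ≡ suc m ∷ suc (suc m) ∷ []
    legs = trans (concatUpTo-pair n (suc m) (suc (suc m)) _ (ℕP.n<1+n (suc m)) (ℕP.n<1+n (suc (suc m)))
             (λ i i<n a b → endsAt-leg-none v i i<n (n≤ m) (subst ((i ∸ 1) ⊓ m ≢_) (sym (ℕP.m+n∸m≡n n m)) (ℕP.<⇒≢ (ℕP.≤-<-trans (ℕP.m⊓n≤m (i ∸ 1) m) (pl i (low i i<n a b)))))))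
             (cong₂ _++_ (endsAt-leg-attached v (suc m) (s≤s (s≤s (ℕP.n≤1+n m))) (cong (n +ℕ_) (sym (ℕP.⊓-idem m))))
                         (endsAt-leg-attached v (suc (suc m)) (ℕP.n<1+n (suc (suc m))) (cong (n +ℕ_) (sym (ℕP.m≥n⇒m⊓n≡n (ℕP.n≤1+n m))))))
    m'<m : m' <ℕ m
    m'<m = subst (m' <ℕ_) (sym em) (ℕP.n<1+n m')
    paths : pathIncidence v ≡ (n +ℕ m') ∷ []
    paths = trans (concatUpTo-single m m' _ m'<m (λ i i<m i≢ → endsAt-none (n +ℕ i) (n +ℕ suc i) v (n +ℕ i) (+≢ n (ℕP.<⇒≢ i<m)) (+≢ n (λ e → i≢ (ℕP.suc-injective (trans e em))))))
       (endsAt-second (n +ℕ m') (n +ℕ suc m') v (n +ℕ m') (+≢ n (ℕP.<⇒≢ m'<m)) (cong (n +ℕ_) (sym em)))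

-- Node inequalities as admissibility

NodeInequalities : ℕ → ℤ → ℤ → ℤ → Set
NodeInequalities t x y z = (x ≤ℤ y + z) × (y ≤ℤ x + z) × (z ≤ℤ x + y) × (x + y + z ≤ℤ + t)

-- Adding the two inequalities gives a + b ≤ a + b + 2c.
triangle⇒0≤ : ∀ {a b c} → a ≤ℤ b + c → b ≤ℤ a + c → + 0 ≤ℤ c
triangle⇒0≤ {a} {b} {c} p q = double c (subst₂ _≤ℤ_ (cancel a b) (cancel′ a b c) (ℤP.+-monoʳ-≤ (- (a + b)) (subst (a + b ≤ℤ_) (collect a b c) (ℤP.+-mono-≤ p q))))
  where
  cancel : ∀ a b → - (a + b) + (a + b) ≡ 0ℤ
  cancel = ZS.solve-∀
  cancel′ : ∀ a b c → - (a + b) + ((a + b) + (c + c)) ≡ c + c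
  cancel′ = ZS.solve-∀
  collect : ∀ a b c → (b + c) + (a + c) ≡ (a + b) + (c + c)
  collect = ZS.solve-∀
  double : ∀ c → 0ℤ ≤ℤ c + c → + 0 ≤ℤ c
  double (+ n) _ = +≤+ z≤n
  double -[1+ n ] ()

0≤⇒ℕ : ∀ {c} → + 0 ≤ℤ c → ∃ λ a → c ≡ + a
0≤⇒ℕ {+ a} _ = a , refl

NodeInequalities-nonneg : ∀ {t x y z} → NodeInequalities t x y z → (∃ λ a → x ≡ + a) × (∃ λ b → y ≡ + b) × (∃ λ c → z ≡ + c)
NodeInequalities-nonneg {t} {x} {y} {z} (p , q , r , s) =
  0≤⇒ℕ (triangle⇒0≤ {y} {z} {x} (subst (y ≤ℤ_) (ℤP.+-comm x z) q) (subst (z ≤ℤ_) (ℤP.+-comm x y) r)) ,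
  0≤⇒ℕ (triangle⇒0≤ {x} {z} {y} (subst (x ≤ℤ_) (ℤP.+-comm y z) p) r) ,
  0≤⇒ℕ (triangle⇒0≤ {x} {y} {z} p q)

module _ (H t : ℕ) (teq : t ≡ H +ℕ H) where
  open Admissibility H hiding (t)

  NodeInequalities⇒Admissible : ∀ {x y z} → NodeInequalities t (+ x) (+ y) (+ z) → Admissible x y z
  NodeInequalities⇒Admissible (p , q , r , s) = ℤP.drop‿+≤+ p , ℤP.drop‿+≤+ q , ℤP.drop‿+≤+ r , subst (_ ≤ℕ_) teq (ℤP.drop‿+≤+ s)

  Admissible⇒NodeInequalities : ∀ {x y z} → Admissible x y z → NodeInequalities t (+ x) (+ y) (+ z)
  Admissible⇒NodeInequalities (p , q , r , s) = +≤+ p , +≤+ q , +≤+ r , +≤+ (subst (_ ≤ℕ_) (sym teq) s)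

  NodeInequalities-bounds : ∀ {x y z} → NodeInequalities t x y z → ((+ 0 ≤ℤ x) × (x ≤ℤ + H)) × ((+ 0 ≤ℤ y) × (y ≤ℤ + H)) × ((+ 0 ≤ℤ z) × (z ≤ℤ + H))
  NodeInequalities-bounds cz with NodeInequalities-nonneg cz
  ... | (a , refl) , (b , refl) , (c , refl) with Admissible-≤H (NodeInequalities⇒Admissible cz)
  ... | p , q , r = (+≤+ z≤n , +≤+ p) , (+≤+ z≤n , +≤+ q) , (+≤+ z≤n , +≤+ r)

bounded⇒toℤ : ∀ H {M} (w : Vec ℤ M) → (∀ a → (+ 0 ≤ℤ w at a) × (w at a ≤ℤ + H)) → ∃ λ u → All (_<ℕ suc H) u × w ≡ toℤ u
bounded⇒toℤ H [] f = [] , [] , refl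
bounded⇒toℤ H (x ∷ w) f with f zero | bounded⇒toℤ H w (λ a → f (suc a))
... | p , q | u , bu , refl with 0≤⇒ℕ p
... | c , refl = c ∷ u , s≤s (ℤP.drop‿+≤+ q) ∷ bu , refl

zero⊎suc : ∀ x → x ≡ 0 ⊎ ∃ λ y → x ≡ suc y
zero⊎suc zero = inj₁ refl
zero⊎suc (suc y) = inj₂ (y , refl)

module HKNodes (H h k m : ℕ) (eq : h +ℕ k ≡ suc (suc (suc m))) where
  open HK h k m eq
  open Admissibility H
  open Caterpillar H

  NodeTriple : ℕ → Set
  NodeTriple j = ∃ λ i0 → ∃ λ i1 → ∃ λ i2 → incidentℕ G (n +ℕ j) ≡ i0 ∷ i1 ∷ i2 ∷ [] × (∀ f → admissibleᵇ (f i0) (f i1) (f i2) ≡ nodeAdmissibleᵇ m f (λ j → f (n +ℕ j)) j)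

  nodeTriple : ∀ j → j ≤ℕ m → NodeTriple j
  nodeTriple j j≤m with zero⊎suc m
  nodeTriple zero j≤m | inj₁ refl = 0 , 1 , 2 , incidentℕ-onlyNode refl , (λ f → refl)
  nodeTriple (suc j) () | inj₁ refl
  nodeTriple zero j≤m | inj₂ (m' , refl) = 0 , 1 , n +ℕ 0 , incidentℕ-firstNode (s≤s z≤n) , (λ f → refl)
  nodeTriple (suc j) j≤m | inj₂ (m' , refl) with ℕP.m≤n⇒m<n∨m≡n j≤m
  ... | inj₁ sj<m = suc (suc j) , n +ℕ j , n +ℕ suc j , incidentℕ-middleNode j sj<m ,
      (λ f → trans (admissibleᵇ-swap (f (suc (suc j))) (f (n +ℕ j)) (f (n +ℕ suc j))) (cong (admissibleᵇ (f (n +ℕ j)) (f (suc (suc j)))) (sym (cf f))))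
    where
    cf : ∀ f → thirdEdge m f (λ j → f (n +ℕ j)) (suc j) ≡ f (n +ℕ suc j)
    cf f rewrite ≢⇒≡ᵇ-false {suc j} {m} (ℕP.<⇒≢ sj<m) = refl
  ... | inj₂ refl = suc m , suc (suc m) , n +ℕ j , incidentℕ-lastNode j refl ,
      (λ f → trans (sym (admissibleᵇ-rotate (f (n +ℕ j)) (f (suc m)) (f (suc (suc m))))) (cong (admissibleᵇ (f (n +ℕ j)) (f (suc m))) (sym (cf f))))
    where
    cf : ∀ f → thirdEdge m f (λ j → f (n +ℕ j)) (suc j) ≡ f (suc (suc m))
    cf f rewrite ≡ᵇ-refl j = refl

  degree-triple : ∀ v {i0 i1 i2 : ℕ} → incidentℕ G v ≡ i0 ∷ i1 ∷ i2 ∷ [] → degree G v ≡ 3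
  degree-triple v e = trans (degree≡length-incidentℕ G v) (cong length e)

  degree-pathNode : ∀ j → j ≤ℕ m → degree G (n +ℕ j) ≡ 3
  degree-pathNode j le with nodeTriple j le
  ... | _ , _ , _ , e , _ = degree-triple (n +ℕ j) e

  degree-loopLeaf : ∀ j → j <ℕ k → degree G (h +ℕ j) ≡ 3
  degree-loopLeaf j lt = degree-triple (h +ℕ j) (incidentℕ-loop j lt)

  edge-trichotomy : ∀ i → i <ℕ n +ℕ m +ℕ k → (i <ℕ n) ⊎ ((∃ λ j → j <ℕ m × i ≡ n +ℕ j) ⊎ (∃ λ j → j <ℕ k × i ≡ n +ℕ m +ℕ j))
  edge-trichotomy i lt with i ℕ.<? n
  ... | Relation.Nullary.yes p = inj₁ p
  ... | Relation.Nullary.no ¬p with ℕP.m≤n⇒∃[o]m+o≡n (ℕP.≮⇒≥ ¬p)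
  ... | r , refl with r ℕ.<? m
  ... | Relation.Nullary.yes q = inj₂ (inj₁ (r , q , refl))
  ... | Relation.Nullary.no ¬q with ℕP.m≤n⇒∃[o]m+o≡n (ℕP.≮⇒≥ ¬q)
  ... | s , refl = inj₂ (inj₂ (s , ℕP.+-cancelˡ-< (n +ℕ m) s k (subst (_<ℕ n +ℕ m +ℕ k) (sym (ℕP.+-assoc n m s)) lt) , sym (ℕP.+-assoc n m s)))

  degree3≢1 : ∀ v → degree G v ≡ 3 → degree G v ≢ 1
  degree3≢1 v d₃ d₁ with trans (sym d₃) d₁
  ... | ()

  leafEndpoint : ∀ (a : Fin (nE G)) {x y} → edgeAt G (toℕ a) ≡ (x , y) → IsLeafEdge G a → degree G x ≡ 1 ⊎ degree G y ≡ 1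
  leafEndpoint a e le = subst (λ e → degree G (proj₁ e) ≡ 1 ⊎ degree G (proj₂ e) ≡ 1) (trans (lookup≡edgeAt G a) e) le

  -- Path nodes and leaves carrying a loop have degree 3, so a leaf-edge is a leg at a leaf < h.
  leafEdge<h : (a : Fin (nE G)) → IsLeafEdge G a → toℕ a <ℕ h
  leafEdge<h a le with edge-trichotomy (toℕ a) (subst (toℕ a <ℕ_) length-G (FinP.toℕ<n a))
  ... | inj₂ (inj₁ (j , j<m , e)) =
    ⊥-elim ([ degree3≢1 (n +ℕ j) (degree-pathNode j (ℕP.<⇒≤ j<m)) , degree3≢1 (n +ℕ suc j) (degree-pathNode (suc j) j<m) ]′ (leafEndpoint a (trans (cong (edgeAt G) e) (edgeAt-path j j<m)) le))
  ... | inj₂ (inj₂ (j , j<k , e)) =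
    ⊥-elim ([ degree3≢1 (h +ℕ j) (degree-loopLeaf j j<k) , degree3≢1 (h +ℕ j) (degree-loopLeaf j j<k) ]′ (leafEndpoint a (trans (cong (edgeAt G) e) (edgeAt-loop j j<k)) le))
  ... | inj₁ i<n = leg (leafEndpoint a (edgeAt-leg (toℕ a) i<n) le)
    where
    leg : degree G (toℕ a) ≡ 1 ⊎ degree G (n +ℕ ((toℕ a ∸ 1) ⊓ m)) ≡ 1 → toℕ a <ℕ h
    leg (inj₂ d) = ⊥-elim (degree3≢1 (n +ℕ ((toℕ a ∸ 1) ⊓ m)) (degree-pathNode _ (⊓≤ (toℕ a ∸ 1))) d)
    leg (inj₁ d) with toℕ a ℕ.<? h
    ... | Relation.Nullary.yes p = p
    ... | Relation.Nullary.no ¬p with ℕP.m≤n⇒∃[o]m+o≡n (ℕP.≮⇒≥ ¬p)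
    ... | j , e = ⊥-elim (degree3≢1 (h +ℕ j) (degree-loopLeaf j (ℕP.+-cancelˡ-< h j k (subst (h +ℕ j <ℕ_) (sym eq) (subst (_<ℕ n) (sym e) i<n)))) (subst (λ z → degree G z ≡ 1) (sym e) d))

  incident-triple⇒node : ∀ v {a b c : Fin (nE G)} → incident G v ≡ a ∷ b ∷ c ∷ [] → (∃ λ j → j <ℕ k × v ≡ h +ℕ j) ⊎ (∃ λ r → r ≤ℕ m × v ≡ n +ℕ r)
  incident-triple⇒node v ei with v ℕ.<? h
  ... | Relation.Nullary.yes v<h with trans (sym (cong (map toℕ) ei)) (trans (map-toℕ-incident G v) (incidentℕ-leaf v v<h))
  ... | ()
  incident-triple⇒node v ei | Relation.Nullary.no v≮h with ℕP.m≤n⇒∃[o]m+o≡n (ℕP.≮⇒≥ v≮h)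
  ... | j , refl with j ℕ.<? k
  ... | Relation.Nullary.yes j<k = inj₁ (j , j<k , refl)
  ... | Relation.Nullary.no j≮k with ℕP.m≤n⇒∃[o]m+o≡n (subst (_≤ℕ h +ℕ j) eq (ℕP.+-monoʳ-≤ h (ℕP.≮⇒≥ j≮k)))
  ... | r , er with r ℕ.≤? m
  ... | Relation.Nullary.yes r≤m = inj₂ (r , r≤m , sym er)
  ... | Relation.Nullary.no r≰m with trans (sym (cong (map toℕ) ei)) (trans (map-toℕ-incident G (h +ℕ j)) (subst (λ z → incidentℕ G z ≡ []) er (incidentℕ-beyond (n +ℕ r) (ℕP.+-monoʳ-< n (ℕP.≰⇒> r≰m)))))
  ... | ()

module HKConstraints (H h k m : ℕ) (eq : h +ℕ k ≡ suc (suc (suc m))) (t : ℕ) (teq : t ≡ H +ℕ H) where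
  open HK h k m eq
  open HKNodes H h k m eq
  open Admissibility H renaming (t to tH)
  open Caterpillar H

  constraintsᵇ : ∀ {M} → Vec ℕ M → Bool
  constraintsᵇ u = all< (suc m) (nodeAdmissibleᵇ m (lookupℕ u) (λ j → lookupℕ u (n +ℕ j))) ∧ all< k (λ j → admissibleᵇ (lookupℕ u (h +ℕ j)) (lookupℕ u (n +ℕ m +ℕ j)) (lookupℕ u (n +ℕ m +ℕ j)))

  M : ℕ
  M = nE G

  nodeConstraints⇒admissibleᵇ : ∀ (u : Vec ℕ M) → NodeConstraints G t (toℤ u) → ∀ v {i0 i1 i2} → incidentℕ G v ≡ i0 ∷ i1 ∷ i2 ∷ [] → T (admissibleᵇ (lookupℕ u i0) (lookupℕ u i1) (lookupℕ u i2))
  nodeConstraints⇒admissibleᵇ u nc v e with incident-triple′ G v e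
  ... | a , b , c , ei , refl , refl , refl with nc v a b c ei
  ... | cz rewrite toℤ-at u a | toℤ-at u b | toℤ-at u c = Admissible⇒admissibleᵇ (NodeInequalities⇒Admissible H t teq cz)

  admissibleᵇ⇒NodeInequalities : ∀ (u : Vec ℕ M) v {i0 i1 i2} → incidentℕ G v ≡ i0 ∷ i1 ∷ i2 ∷ [] → T (admissibleᵇ (lookupℕ u i0) (lookupℕ u i1) (lookupℕ u i2)) →
          ∀ a b c → incident G v ≡ a ∷ b ∷ c ∷ [] → NodeInequalities t (toℤ u at a) (toℤ u at b) (toℤ u at c)
  admissibleᵇ⇒NodeInequalities u v e p a b c ei with incident-triple G v a b c e ei
  ... | refl , refl , refl rewrite toℤ-at u a | toℤ-at u b | toℤ-at u c = Admissible⇒NodeInequalities H t teq (admissibleᵇ⇒Admissible p)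

  inDilate⇒goodᵇ : ∀ u → InDilate G t (toℤ u) → T (constraintsᵇ u)
  inDilate⇒goodᵇ u (nc , _) = T-∧-intro (all<-intro (suc m) _ (λ j j<sm → ch j (ℕ.s≤s⁻¹ j<sm))) (all<-intro k _ (λ j j<k → nodeConstraints⇒admissibleᵇ u nc (h +ℕ j) (incidentℕ-loop j j<k)))
    where
    ch : ∀ j → j ≤ℕ m → T (nodeAdmissibleᵇ m (lookupℕ u) (λ j → lookupℕ u (n +ℕ j)) j)
    ch j le with nodeTriple j le
    ... | i0 , i1 , i2 , e , pf = subst T (pf (lookupℕ u)) (nodeConstraints⇒admissibleᵇ u nc (n +ℕ j) e)

  nE≢1 : nE G ≢ 1
  nE≢1 e with trans (sym length-G) e
  ... | ()

  goodᵇ⇒inDilate : ∀ u → T (constraintsᵇ u) → InDilate G t (toℤ u)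
  goodᵇ⇒inDilate u g = nc , (λ _ e → ⊥-elim (nE≢1 e))
    where
    pathNodes loops : Bool
    pathNodes = all< (suc m) (nodeAdmissibleᵇ m (lookupℕ u) (λ j → lookupℕ u (n +ℕ j)))
    loops = all< k (λ j → admissibleᵇ (lookupℕ u (h +ℕ j)) (lookupℕ u (n +ℕ m +ℕ j)) (lookupℕ u (n +ℕ m +ℕ j)))
    nc : NodeConstraints G t (toℤ u)
    nc v a b c ei with incident-triple⇒node v ei
    ... | inj₁ (j , j<k , refl) = admissibleᵇ⇒NodeInequalities u (h +ℕ j) (incidentℕ-loop j j<k) (all<-elim k (λ j → admissibleᵇ (lookupℕ u (h +ℕ j)) (lookupℕ u (n +ℕ m +ℕ j)) (lookupℕ u (n +ℕ m +ℕ j))) j (T-∧-r {pathNodes} g) j<k) a b c ei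
    ... | inj₂ (r , r≤m , refl) with nodeTriple r r≤m
    ... | i0 , i1 , i2 , e , pf = admissibleᵇ⇒NodeInequalities u (n +ℕ r) e (subst T (sym (pf (lookupℕ u))) (all<-elim (suc m) (nodeAdmissibleᵇ m (lookupℕ u) (λ j → lookupℕ u (n +ℕ j))) r (T-∧-l {pathNodes} {loops} g) (s≤s r≤m))) a b c ei

  InRange : Vec ℤ M → Fin M → Set
  InRange w a = (+ 0 ≤ℤ w at a) × (w at a ≤ℤ + H)

  InRange-triple : ∀ (w : Vec ℤ M) (a a' b' c' : Fin M) → NodeInequalities t (w at a') (w at b') (w at c') → toℕ a ∈ toℕ a' ∷ toℕ b' ∷ toℕ c' ∷ [] → InRange w a
  InRange-triple w a a' b' c' cz mem = go mem (NodeInequalities-bounds H t teq cz)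
    where
    go : toℕ a ∈ toℕ a' ∷ toℕ b' ∷ toℕ c' ∷ [] → InRange w a' × InRange w b' × InRange w c' → InRange w a
    go (Any.here p) (ba , _ , _) = subst (InRange w) (sym (FinP.toℕ-injective p)) ba
    go (Any.there (Any.here p)) (_ , bb , _) = subst (InRange w) (sym (FinP.toℕ-injective p)) bb
    go (Any.there (Any.there (Any.here p))) (_ , _ , bc) = subst (InRange w) (sym (FinP.toℕ-injective p)) bc

  InRange-incident : ∀ (w : Vec ℤ M) → NodeConstraints G t w → ∀ v {i0 i1 i2} → incidentℕ G v ≡ i0 ∷ i1 ∷ i2 ∷ [] → ∀ (a : Fin M) → toℕ a ∈ i0 ∷ i1 ∷ i2 ∷ [] → InRange w a
  InRange-incident w nc v {i0} {i1} {i2} e a mem = go (incident-triple′ G v e)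
    where
    go : (∃ λ a' → ∃ λ b' → ∃ λ c' → incident G v ≡ a' ∷ b' ∷ c' ∷ [] × toℕ a' ≡ i0 × toℕ b' ≡ i1 × toℕ c' ≡ i2) → InRange w a
    go (a' , b' , c' , ei , ea , eb , ec) = InRange-triple w a a' b' c' (nc v a' b' c' ei) (subst (λ L → toℕ a ∈ L) (sym (cong₂ (λ x y → x ∷ y) ea (cong₂ (λ x y → x ∷ y) eb (cong (λ x → x ∷ []) ec)))) mem)

  -- Every edge is incident with a node of degree 3, whose inequalities confine it to [0, H].
  inDilate⇒bounded : ∀ w → InDilate G t w → ∃ λ u → All (_<ℕ suc H) u × w ≡ toℤ u
  inDilate⇒bounded w (nc , _) = bounded⇒toℤ H w inRange
    where
    inRange-node : ∀ (a : Fin M) v {i0 i1 i2} → incidentℕ G v ≡ i0 ∷ i1 ∷ i2 ∷ [] → toℕ a ∈ incidentℕ G v → InRange w a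
    inRange-node a v e mem = InRange-incident w nc v e a (subst (λ z → toℕ a ∈ z) e mem)
    inRange-pathNode : ∀ (a : Fin M) j → j ≤ℕ m → toℕ a ∈ incidentℕ G (n +ℕ j) → InRange w a
    inRange-pathNode a j le mem = go (nodeTriple j le)
      where
      go : NodeTriple j → InRange w a
      go (i0 , i1 , i2 , e , _) = inRange-node a (n +ℕ j) e mem
    inRange : ∀ a → InRange w a
    inRange a = go (edge-trichotomy (toℕ a) (subst (toℕ a <ℕ_) length-G (FinP.toℕ<n a)))
      where
      lt : toℕ a <ℕ length G
      lt = FinP.toℕ<n a
      go : (toℕ a <ℕ n) ⊎ ((∃ λ j → j <ℕ m × toℕ a ≡ n +ℕ j) ⊎ (∃ λ j → j <ℕ k × toℕ a ≡ n +ℕ m +ℕ j)) → InRange w a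
      go (inj₁ i<n) = inRange-pathNode a ((toℕ a ∸ 1) ⊓ m) (⊓≤ (toℕ a ∸ 1)) (subst (λ q → toℕ a ∈ incidentℕ G (proj₂ q)) (edgeAt-leg (toℕ a) i<n) (∈-incidentℕ₂ G (toℕ a) lt))
      go (inj₂ (inj₁ (j , j<m , ea))) = inRange-pathNode a j (ℕP.<⇒≤ j<m) (subst (λ q → toℕ a ∈ incidentℕ G (proj₁ q)) (trans (cong (edgeAt G) ea) (edgeAt-path j j<m)) (∈-incidentℕ₁ G (toℕ a) lt))
      go (inj₂ (inj₂ (j , j<k , ea))) = inRange-node a (h +ℕ j) (incidentℕ-loop j j<k) (subst (λ q → toℕ a ∈ incidentℕ G (proj₁ q)) (trans (cong (edgeAt G) ea) (edgeAt-loop j j<k)) (∈-incidentℕ₁ G (toℕ a) lt))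

module HKEvaluation (H h k m : ℕ) (eq : h +ℕ k ≡ suc (suc (suc m))) (t : ℕ) (teq : t ≡ H +ℕ H) (A : ℕ) (A<h : A <ℕ h) where
  open HK h k m eq
  open HKNodes H h k m eq
  open Admissibility H renaming (t to tH)
  open Caterpillar H
  open HKConstraints H h k m eq t teq
  open VectorSum N

  A<n : A <ℕ n
  A<n = ℕP.<-≤-trans A<h h≤n

  legWeight : ℕ → ℕ → ℤ
  legWeight i z = if i ≡ᵇ A then sign z else (if i ℕ.<ᵇ h then 1ℤ else loopCount z)

  loopsAdmissibleᵇ : Vec ℕ n → Vec ℕ k → Bool
  loopsAdmissibleᵇ x y = all< k (λ j → admissibleᵇ (lookupℕ x (h +ℕ j)) (lookupℕ y j) (lookupℕ y j))

  summand-split : ∀ (x : Vec ℕ n) (p : Vec ℕ m) (y : Vec ℕ k) →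
        sign (lookupℕ ((x Vec.++ p) Vec.++ y) A) * χ (constraintsᵇ ((x Vec.++ p) Vec.++ y)) ≡ sign (lookupℕ x A) * (χ (chainAdmissibleᵇ m x p) * χ (loopsAdmissibleᵇ x y))
  summand-split x p y = cong₂ _*_ (cong sign lkA) (trans (χ-∧ (all< (suc m) (nodeAdmissibleᵇ m (lookupℕ U) (λ j → lookupℕ U (n +ℕ j)))) (all< k (λ j → admissibleᵇ (lookupℕ U (h +ℕ j)) (lookupℕ U (n +ℕ m +ℕ j)) (lookupℕ U (n +ℕ m +ℕ j))))) (cong₂ _*_ (cong χ chainEq) (cong χ loopEq)))
    where
    U = (x Vec.++ p) Vec.++ y
    lkx : ∀ i → i <ℕ n → lookupℕ U i ≡ lookupℕ x i
    lkx i lt = trans (lookupℕ-++ˡ (x Vec.++ p) y i (ℕP.<-≤-trans lt (ℕP.m≤m+n n m))) (lookupℕ-++ˡ x p i lt)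
    lkp : ∀ j → j <ℕ m → lookupℕ U (n +ℕ j) ≡ lookupℕ p j
    lkp j lt = trans (lookupℕ-++ˡ (x Vec.++ p) y (n +ℕ j) (ℕP.+-monoʳ-< n lt)) (lookupℕ-++ʳ x p j)
    lkA : lookupℕ U A ≡ lookupℕ x A
    lkA = lkx A A<n
    chainEq : all< (suc m) (nodeAdmissibleᵇ m (lookupℕ U) (λ j → lookupℕ U (n +ℕ j))) ≡ chainAdmissibleᵇ m x p
    chainEq = trans (all<-cong (suc m) (λ j lt → nodeAdmissibleᵇ-cong m lkx lkp j (ℕ.s≤s⁻¹ lt))) (all<-nodeAdmissibleᵇ m x p)
    loopEq : all< k (λ j → admissibleᵇ (lookupℕ U (h +ℕ j)) (lookupℕ U (n +ℕ m +ℕ j)) (lookupℕ U (n +ℕ m +ℕ j))) ≡ loopsAdmissibleᵇ x y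
    loopEq = all<-cong k (λ j lt → cong₃ (lkx (h +ℕ j) (h<n lt)) (lookupℕ-++ʳ (x Vec.++ p) y j))
      where
      cong₃ : ∀ {a a' b b'} → a ≡ a' → b ≡ b' → admissibleᵇ a b b ≡ admissibleᵇ a' b' b'
      cong₃ refl refl = refl

  legWeight-<h : ∀ i z → i <ℕ h → legWeight i z ≡ (if i ≡ᵇ A then sign z else 1ℤ)
  legWeight-<h i z lt with i ≡ᵇ A
  ... | true = refl
  ... | false rewrite Equivalence.to BP.T-≡ (ℕP.<⇒<ᵇ lt) = refl

  legWeight-loop : ∀ j z → legWeight (h +ℕ j) z ≡ loopCount z
  legWeight-loop j z rewrite ≢⇒≡ᵇ-false {h +ℕ j} {A} (ℕP.>⇒≢ (ℕP.<-≤-trans A<h (ℕP.m≤m+n h j))) | ¬T⇒false {h +ℕ j ℕ.<ᵇ h} (λ tt' → ℕP.<⇒≱ (ℕP.<ᵇ⇒< (h +ℕ j) h tt') (ℕP.m≤m+n h j)) = refl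

  ∏-loopCount : Vec ℕ n → ℤ
  ∏-loopCount x = ∏ k (λ j → loopCount (lookupℕ x (h +ℕ j)))

  ∏-legs-legWeight : ∀ x → ∏-legs legWeight x ≡ sign (lookupℕ x A) * ∏-loopCount x
  ∏-legs-legWeight x = trans (∏-legs≡∏ legWeight x) (trans (cong (λ z → ∏ z (λ i → legWeight i (lookupℕ x i))) (sym eq)) (trans (∏-split h k (λ i → legWeight i (lookupℕ x i)))
     (cong₂ _*_ (trans (∏-cong h (λ i lt → legWeight-<h i (lookupℕ x i) lt)) (∏-single h (λ i → sign (lookupℕ x i)) A A<h)) (∏-cong k (λ j _ → legWeight-loop j (lookupℕ x (h +ℕ j)))))))

  signedCount≡chainSum : ∀ M' → M' ≡ n +ℕ m +ℕ k → ∑ᵥ M' (λ u → sign (lookupℕ u A) * χ (constraintsᵇ u)) ≡ chainSum m legWeight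
  signedCount≡chainSum M' refl = begin
      ∑ᵥ (n +ℕ m +ℕ k) F
        ≡⟨ ∑ᵥ-++ (n +ℕ m) k F ⟩
      ∑ᵥ (n +ℕ m) (λ xp → ∑ᵥ k (λ y → F (xp Vec.++ y)))
        ≡⟨ ∑ᵥ-++ n m (λ xp → ∑ᵥ k (λ y → F (xp Vec.++ y))) ⟩
      ∑ᵥ n (λ x → ∑ᵥ m (λ p → ∑ᵥ k (λ y → F ((x Vec.++ p) Vec.++ y))))
        ≡⟨ ∑ᵥ-cong n (λ x _ → ∑ᵥ-cong m (λ p _ → trans (∑ᵥ-cong k (λ y _ → trans (summand-split x p y) (sym (ℤP.*-assoc (sign (lookupℕ x A)) _ _))))
              (trans (∑ᵥ-*ˡ k (sign (lookupℕ x A) * χ (chainAdmissibleᵇ m x p)) (λ y → χ (loopsAdmissibleᵇ x y))) (cong ((sign (lookupℕ x A) * χ (chainAdmissibleᵇ m x p)) *_) (∑ᵥ-all< k (λ j z → admissibleᵇ (lookupℕ x (h +ℕ j)) z z)))))) ⟩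
      ∑ᵥ n (λ x → ∑ᵥ m (λ p → (sign (lookupℕ x A) * χ (chainAdmissibleᵇ m x p)) * ∏-loopCount x))
        ≡⟨ ∑ᵥ-cong n (λ x _ → ∑ᵥ-cong m (λ p _ → trans (r (sign (lookupℕ x A)) (χ (chainAdmissibleᵇ m x p)) (∏-loopCount x)) (cong (_* χ (chainAdmissibleᵇ m x p)) (sym (∏-legs-legWeight x))))) ⟩
      chainSum m legWeight ∎
    where
    open ≡-Reasoning
    F : Vec ℕ (n +ℕ m +ℕ k) → ℤ
    F u = sign (lookupℕ u A) * χ (constraintsᵇ u)
    r : ∀ a b c → (a * b) * c ≡ (a * c) * b
    r = ZS.solve-∀

  -- [H even]^{h−1} (H + 1)^k, as a product over the legs without a loop.
  closedForm : ℤ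
  closedForm = ∏ h (λ i → if i ≡ᵇ A then 1ℤ else χ (isEven H)) * + (N ℕ.^ k)

  chainSum≡closedForm : chainSum m legWeight ≡ closedForm
  chainSum≡closedForm = begin
    chainSum m legWeight
      ≡⟨ chainSum-sign-leg m legWeight a' hyp ⟩
    ∏-signed-except n legWeight a'
      ≡⟨ ∏-signed-except≡∏ n legWeight a' ⟩
    ∏ n (λ i → if i ≡ᵇ toℕ a' then 1ℤ else signed (legWeight i))
      ≡⟨ cong (λ z → ∏ n (λ i → if i ≡ᵇ z then 1ℤ else signed (legWeight i))) (FinP.toℕ-fromℕ< A<n) ⟩
    ∏ n F
      ≡⟨ cong (λ z → ∏ z F) (sym eq) ⟩
    ∏ (h +ℕ k) F
      ≡⟨ ∏-split h k F ⟩
    ∏ h F * ∏ k (λ j → F (h +ℕ j))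
      ≡⟨ cong₂ _*_ (∏-cong h low) (trans (∏-cong k high) (∏-const k N)) ⟩
    closedForm ∎
    where
    open ≡-Reasoning
    F : ℕ → ℤ
    F i = if i ≡ᵇ A then 1ℤ else signed (legWeight i)
    a' : Fin n
    a' = Data.Fin.fromℕ< A<n
    hyp : ∀ z → legWeight (toℕ a') z ≡ sign z
    hyp z rewrite FinP.toℕ-fromℕ< A<n | ≡ᵇ-refl A = refl
    low : ∀ i → i <ℕ h → F i ≡ (if i ≡ᵇ A then 1ℤ else χ (isEven H))
    low i lt = low-by (i ≡ᵇ A) refl
      where
      low-by : ∀ b → (i ≡ᵇ A) ≡ b → (if b then 1ℤ else signed (legWeight i)) ≡ (if b then 1ℤ else χ (isEven H))
      low-by true e = refl
      low-by false e = trans (∑-cong N (λ z _ → trans (cong (sign z *_) (trans (legWeight-<h i z lt) (cong (λ b → if b then sign z else 1ℤ) e))) (ℤP.*-identityʳ (sign z)))) (∑-sign-upTo H)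
    high : ∀ j → j <ℕ k → F (h +ℕ j) ≡ + N
    high j _ = high-by (h +ℕ j ≡ᵇ A) (≢⇒≡ᵇ-false {h +ℕ j} {A} (ℕP.>⇒≢ (ℕP.<-≤-trans A<h (ℕP.m≤m+n h j))))
      where
      high-by : ∀ b → b ≡ false → (if b then 1ℤ else signed (legWeight (h +ℕ j))) ≡ + N
      high-by false _ = trans (∑-cong N (λ z _ → cong (sign z *_) (legWeight-loop j z))) signed-loopCount

  closedForm-even : isEven H ≡ true → closedForm ≡ + (N ℕ.^ k)
  closedForm-even e rewrite e = trans (cong (_* + (N ℕ.^ k)) (trans (∏-cong h (λ i _ → if-same i)) (∏-1 h))) (ℤP.*-identityˡ _)
    where
    if-same : ∀ i → (if i ≡ᵇ A then 1ℤ else 1ℤ) ≡ 1ℤ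
    if-same i with i ≡ᵇ A
    ... | true = refl
    ... | false = refl

  closedForm-h≡1 : h ≡ 1 → closedForm ≡ + (N ℕ.^ k)
  closedForm-h≡1 e = trans (cong (_* + (N ℕ.^ k)) (trans (cong (λ z → ∏ z (λ i → if i ≡ᵇ A then 1ℤ else χ (isEven H))) e)
                 (trans (ℤP.*-identityʳ _) (cong (λ a → if 0 ≡ᵇ a then 1ℤ else χ (isEven H)) A0)))) (ℤP.*-identityˡ _)
    where
    A0 : A ≡ 0
    A0 = ℕP.n<1⇒n≡0 (subst (A <ℕ_) e A<h)

  closedForm-odd : isEven H ≡ false → 2 ≤ℕ h → closedForm ≡ 0ℤ
  closedForm-odd e h2 = cong (_* + (N ℕ.^ k)) (∏-zero h _ i i<h fi)
    where
    -- a loopless leg other than the leg a; its factor is [H even] = 0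
    i : ℕ
    i = if A ≡ᵇ 0 then 1 else 0
    i<h : i <ℕ h
    i<h with A ≡ᵇ 0
    ... | true = h2
    ... | false = ℕP.<-≤-trans (s≤s z≤n) h2
    fi : (if i ≡ᵇ A then 1ℤ else χ (isEven H)) ≡ 0ℤ
    fi rewrite e = other-leg A
      where
      other-leg : ∀ A → (if (if A ≡ᵇ 0 then 1 else 0) ≡ᵇ A then 1ℤ else 0ℤ) ≡ 0ℤ
      other-leg zero = refl
      other-leg (suc zero) = refl
      other-leg (suc (suc A)) = refl

*2%4 : ∀ q → (q *ℕ 2) % 4 ≡ (if isEven q then 0 else 2)
*2%4 zero = refl
*2%4 (suc zero) = refl
*2%4 (suc (suc q)) = trans (cong (_% 4) (shift q)) (trans (DM.[m+n]%n≡m%n (q *ℕ 2) 4) (*2%4 q))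
  where
  shift : ∀ q → suc (suc q) *ℕ 2 ≡ q *ℕ 2 +ℕ 4
  shift = NS.solve-∀

%4≡0⇒isEven : ∀ q → (q *ℕ 2) % 4 ≡ 0 → isEven q ≡ true
%4≡0⇒isEven q e with isEven q | *2%4 q
... | true | _ = refl
... | false | m4 with trans (sym m4) e
... | ()

%4≡2⇒¬isEven : ∀ q → (q *ℕ 2) % 4 ≡ 2 → isEven q ≡ false
%4≡2⇒¬isEven q e with isEven q | *2%4 q
... | false | _ = refl
... | true | m4 with trans (sym m4) e
... | ()

half-double : ∀ q k → + ((q *ℕ 2 / 2 +ℕ 1) ^ k) ≡ + (suc q ^ k)
half-double q k = cong (λ z → + (z ^ k)) (trans (cong (_+ℕ 1) (DM.m*n/n≡m q 2)) (ℕP.+-comm q 1))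

q*2≡q+q : ∀ q → q *ℕ 2 ≡ q +ℕ q
q*2≡q+q = NS.solve-∀

Conclusion : (h k : ℕ) (G : Graph) (a : Fin (nE G)) (t : ℕ) → Set
Conclusion h k G a t = Σ[ ne ∈ ℕ ] Σ[ no ∈ ℕ ] VolEv G a t ne × VolOd G a t no ×
      ((t % 4 ≡ 0 ⊎ h ≡ 1) → (+ ne) - (+ no) ≡ + ((t / 2 +ℕ 1) ^ k)) ×
      ((t % 4 ≡ 2 × 2 ≤ℕ h) → (+ ne) - (+ no) ≡ + 0)

conclusion : ∀ h k G a q X → (Σ[ ne ∈ ℕ ] Σ[ no ∈ ℕ ] VolEv G a (q *ℕ 2) ne × VolOd G a (q *ℕ 2) no × ((+ ne) - (+ no) ≡ X)) →
   ((q *ℕ 2 % 4 ≡ 0 ⊎ h ≡ 1) → X ≡ + (suc q ^ k)) → ((q *ℕ 2 % 4 ≡ 2 × 2 ≤ℕ h) → X ≡ 0ℤ) → Conclusion h k G a (q *ℕ 2)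
conclusion h k G a q X (ne , no , ve , vo , d) c1 c2 = ne , no , ve , vo , (λ c → trans d (trans (c1 c) (sym (half-double q k)))) , (λ c → trans d (c2 c))

lemma14-large : (h k m : ℕ) (eq : h +ℕ k ≡ suc (suc (suc m))) (a : Fin (nE (HK.G h k m eq))) → IsLeafEdge (HK.G h k m eq) a → (q : ℕ) → Conclusion h k (HK.G h k m eq) a (q *ℕ 2)
lemma14-large h k m eq a le q = conclusion h k G a q (chainSum m legWeight)
    (let (ne , no , ve , vo , d) = Enumeration.vol-ev-minus-od (suc q) G (q *ℕ 2) a constraintsᵇ inDilate⇒bounded (λ u _ → inDilate⇒goodᵇ u) (λ u _ → goodᵇ⇒inDilate u)
     in ne , no , ve , vo , trans d (trans (VectorSum.∑ᵥ-cong (suc q) (nE G) (λ u _ → cong (λ z → sign z * χ (constraintsᵇ u)) (lookup≡lookupℕ u a))) (signedCount≡chainSum (nE G) length-G)))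
    (λ { (inj₁ e) → trans chainSum≡closedForm (closedForm-even (%4≡0⇒isEven q e)) ; (inj₂ e) → trans chainSum≡closedForm (closedForm-h≡1 e) })
    (λ { (e , h2) → trans chainSum≡closedForm (closedForm-odd (%4≡2⇒¬isEven q e) h2) })
  where
  open HK h k m eq
  A<h : toℕ a <ℕ h
  A<h = HKNodes.leafEdge<h q h k m eq a le
  open HKConstraints q h k m eq (q *ℕ 2) (q*2≡q+q q)
  open HKEvaluation q h k m eq (q *ℕ 2) (q*2≡q+q q) (toℕ a) A<h
  open Caterpillar q using (chainSum)

singleEdge : Graph
singleEdge = (0 , 1) ∷ []

lemma14-singleEdge : (a : Fin (nE singleEdge)) (q : ℕ) → Conclusion 2 0 singleEdge a (q *ℕ 2)
lemma14-singleEdge zero q = conclusion 2 0 singleEdge zero q (χ (isEven q))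
    (let (ne , no , ve , vo , d) = Enumeration.vol-ev-minus-od (suc q) singleEdge (q *ℕ 2) zero (λ _ → true) inDilate⇒bounded (λ u _ _ → tt) goodᵇ⇒inDilate
     in ne , no , ve , vo , trans d (trans (∑-cong (suc q) (λ x _ → ℤP.*-identityʳ (sign x))) (∑-sign-upTo q)))
    (λ { (inj₁ e) → cong χ (%4≡0⇒isEven q e) ; (inj₂ ()) })
    (λ { (e , _) → cong χ (%4≡2⇒¬isEven q e) })
  where
  t = q *ℕ 2
  inDilate⇒bounded : ∀ w → InDilate singleEdge t w → ∃ λ u → All (_<ℕ suc q) u × w ≡ toℤ u
  inDilate⇒bounded (x ∷ []) (_ , sc) with sc zero refl
  ... | p , r with 0≤⇒ℕ p
  ... | c , refl = c ∷ [] , s≤s (ℕP.*-cancelˡ-≤ 2 (subst (2 *ℕ c ≤ℕ_) (ℕP.*-comm q 2) (ℤP.drop‿+≤+ (subst (_≤ℤ + t) (sym (ℤP.pos-* 2 c)) r)))) ∷ [] , refl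
  goodᵇ⇒inDilate : ∀ u → All (_<ℕ suc q) u → T true → InDilate singleEdge t (toℤ u)
  goodᵇ⇒inDilate (c ∷ []) (s≤s c≤q ∷ []) _ = nc , sc
    where
    nc : NodeConstraints singleEdge t (toℤ (c ∷ []))
    nc zero a b d ()
    nc (suc zero) a b d ()
    nc (suc (suc v)) a b d ()
    sc : SingleEdgeConstraints singleEdge t (toℤ (c ∷ []))
    sc zero _ = +≤+ z≤n , subst (_≤ℤ + t) (ℤP.pos-* 2 c) (+≤+ (subst (2 *ℕ c ≤ℕ_) (ℕP.*-comm 2 q) (ℕP.*-monoʳ-≤ 2 c≤q)))

edgeWithLoop : Graph
edgeWithLoop = (0 , 1) ∷ (1 , 1) ∷ []

lemma14-edgeWithLoop : (a : Fin (nE edgeWithLoop)) → IsLeafEdge edgeWithLoop a → (q : ℕ) → Conclusion 1 1 edgeWithLoop a (q *ℕ 2)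
lemma14-edgeWithLoop (suc zero) (inj₁ ()) q
lemma14-edgeWithLoop (suc zero) (inj₂ ()) q
lemma14-edgeWithLoop zero _ q = conclusion 1 1 edgeWithLoop zero q (+ suc q)
    (let (ne , no , ve , vo , d) = Enumeration.vol-ev-minus-od (suc q) edgeWithLoop (q *ℕ 2) zero good inDilate⇒bounded inDilate⇒goodᵇ goodᵇ⇒inDilate
     in ne , no , ve , vo , trans d (trans (∑-cong (suc q) (λ x _ → ∑-*ˡ (suc q) (sign x) (λ y → χ (admissibleᵇ x y y)))) signed-loopCount))
    (λ _ → cong +_ (sym (ℕP.*-identityʳ (suc q))))
    (λ { (_ , s≤s ()) })
  where
  t = q *ℕ 2
  open Admissibility q using (admissibleᵇ; signed-loopCount)
  good : Vec ℕ 2 → Bool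
  good u = admissibleᵇ (lookupℕ u 0) (lookupℕ u 1) (lookupℕ u 1)
  inDilate⇒bounded : ∀ w → InDilate edgeWithLoop t w → ∃ λ u → All (_<ℕ suc q) u × w ≡ toℤ u
  inDilate⇒bounded (x ∷ y ∷ []) (nc , _) with NodeInequalities-bounds q t (q*2≡q+q q) (nc 1 zero (suc zero) (suc zero) refl)
  ... | bx , by , _ = bounded⇒toℤ q (x ∷ y ∷ []) f
    where
    f : ∀ a → (+ 0 ≤ℤ (x ∷ y ∷ []) at a) × ((x ∷ y ∷ []) at a ≤ℤ + q)
    f zero = bx
    f (suc zero) = by
  inDilate⇒goodᵇ : ∀ u → All (_<ℕ suc q) u → InDilate edgeWithLoop t (toℤ u) → T (good u)
  inDilate⇒goodᵇ (x ∷ y ∷ []) _ (nc , _) = Admissibility.Admissible⇒admissibleᵇ q (NodeInequalities⇒Admissible q t (q*2≡q+q q) (nc 1 zero (suc zero) (suc zero) refl))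
  goodᵇ⇒inDilate : ∀ u → All (_<ℕ suc q) u → T (good u) → InDilate edgeWithLoop t (toℤ u)
  goodᵇ⇒inDilate (x ∷ y ∷ []) _ g = nc , sc
    where
    nc : NodeConstraints edgeWithLoop t (toℤ (x ∷ y ∷ []))
    nc zero a b d ()
    nc (suc zero) .zero .(suc zero) .(suc zero) refl = Admissible⇒NodeInequalities q t (q*2≡q+q q) (Admissibility.admissibleᵇ⇒Admissible q g)
    nc (suc (suc v)) a b d ()
    sc : SingleEdgeConstraints edgeWithLoop t (toℤ (x ∷ y ∷ []))
    sc e ()

lemma14-even : (h k n : ℕ) → h +ℕ k ≡ n → 1 ≤ℕ h → 2 ≤ℕ n →
    (a : Fin (nE (caterpillar n ++ loopsAt h k))) → IsLeafEdge (caterpillar n ++ loopsAt h k) a →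
    (q : ℕ) → Conclusion h k (caterpillar n ++ loopsAt h k) a (q *ℕ 2)
lemma14-even h k (suc (suc (suc m))) eq _ _ a le q = lemma14-large h k m eq a le q
lemma14-even 1 1 2 refl _ _ a le q = lemma14-edgeWithLoop a le q
lemma14-even 2 0 2 refl _ _ a le q = lemma14-singleEdge a q
lemma14-even 0 _ 2 _ ()
lemma14-even 1 0 2 ()
lemma14-even 1 (suc (suc _)) 2 ()
lemma14-even 2 (suc _) 2 ()
lemma14-even (suc (suc (suc _))) _ 2 ()
lemma14-even _ _ 0 _ _ ()
lemma14-even _ _ 1 _ _ (s≤s ())

lemma14 : (h k : ℕ) → 1 ≤ℕ h → 2 ≤ℕ h +ℕ k →
    (a : Fin (nE (Ghk h k))) → IsLeafEdge (Ghk h k) a →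
    (t : ℕ) → 2 ∣ℕ t →
    Σ[ ne ∈ ℕ ] Σ[ no ∈ ℕ ] VolEv (Ghk h k) a t ne × VolOd (Ghk h k) a t no ×
    ((t % 4 ≡ 0 ⊎ h ≡ 1) → (+ ne) - (+ no) ≡ + ((t / 2 +ℕ 1) ^ k)) ×
    ((t % 4 ≡ 2 × 2 ≤ℕ h) → (+ ne) - (+ no) ≡ + 0)
lemma14 h k 1≤h 2≤h+k a le .(q *ℕ 2) (divides q refl) = lemma14-even h k (h +ℕ k) refl 1≤h 2≤h+k a le q
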